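{- $\mathrm{sat}^*(n,\mathcal N)=\Theta(n)$; that is, there exist constants $c,C>0$ such that $c\,n\le \mathrm{sat}^*(n,\mathcal N)\le C\,n$ for all sufficiently large $n$.
   Context: For $n\ge 1$ let $[n]=\{1,\dots,n\}$ and let $\mathcal P([n])$ be its power set ordered by inclusion. The poset $\mathcal N$ has four elements $a,b,c,d$ with $a<c$, $b<c$, $b<d$ and no other comparabilities. A family $\mathcal F\subseteq\mathcal P([n])$ contains an induced copy of $\mathcal N$ if there are distinct $P,Q,R,S\in\mathcal F$ with $P\subset R$, $Q\subset R$, $Q\subset S$, and such that each of the pairs $\{P,Q\}$, $\{P,S\}$, $\{R,S\}$ is incomparable under inclusion. A family $\mathcal F\subseteq\mathcal P([n])$ is $\mathcal N$-saturated if $\mathcal F$ contains no induced copy of $\mathcal N$, but for every $X\in\mathcal P([n])\setminus\mathcal F$ the family $\mathcal F\cup\{X\}$ contains an induced copy of $\mathcal N$. The induced saturation number $\mathrm{sat}^*(n,\mathcal N)$ is the minimum size of an $\mathcal N$-saturated family $\mathcal F\subseteq\mathcal P([n])$. -}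

module Defs where

open import Data.Nat using (ℕ)
open import Data.Product using (Σ; ∃; _×_)
open import Data.List using (List; length)
import Data.List.Membership.Propositional as LM
open import Data.List.Relation.Unary.Unique.Propositional using (Unique)
open import Data.Fin.Subset using (Subset; _⊆_; _⊂_)
open import Relation.Nullary using (¬_)
open import Relation.Binary.PropositionalEquality using (_≢_)

-- A family F ⊆ P([n]) is a duplicate-free list of subsets of [n] = Fin n;
-- its size |F| is the length of the list.
record Family (n : ℕ) : Set where
  constructor family
  field
    members : List (Subset n)
    unique  : Unique members
open Family public

_∈F_ : ∀ {n} → Subset n → Family n → Set
X ∈F F = X LM.∈ members F

_∉F_ : ∀ {n} → Subset n → Family n → Set
X ∉F F = ¬ (X ∈F F)

size : ∀ {n} → Family n → ℕ
size F = length (members F)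

Incomparable : ∀ {n} → Subset n → Subset n → Set
Incomparable A B = ¬ (A ⊆ B) × ¬ (B ⊆ A)

InducedN : ∀ {n} → Subset n → Subset n → Subset n → Subset n → Set
InducedN P Q R S =
  (P ≢ Q) × (P ≢ R) × (P ≢ S) × (Q ≢ R) × (Q ≢ S) × (R ≢ S) ×
  (P ⊂ R) × (Q ⊂ R) × (Q ⊂ S) ×
  Incomparable P Q × Incomparable P S × Incomparable R S

ContainsN : ∀ {n} → (Subset n → Set) → Set
ContainsN {n} Mem =
  Σ (Subset n) λ P → Σ (Subset n) λ Q → Σ (Subset n) λ R → Σ (Subset n) λ S →
    Mem P × Mem Q × Mem R × Mem S × InducedN P Q R S

_∪₁_ : ∀ {n} → Family n → Subset n → (Subset n → Set)
(F ∪₁ X) Y = (Y ∈F F) Data.Sum.⊎ (Y Relation.Binary.PropositionalEquality.≡ X)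
  where import Data.Sum
        import Relation.Binary.PropositionalEquality

NSaturated : ∀ {n} → Family n → Set
NSaturated {n} F =
  ¬ ContainsN (_∈F F) ×
  (∀ (X : Subset n) → X ∉F F → ContainsN (F ∪₁ X))

IsSatStar : ℕ → ℕ → Set
IsSatStar n m =
  (Σ (Family n) λ F → NSaturated F × size F Relation.Binary.PropositionalEquality.≡ m) ×
  (∀ (F : Family n) → NSaturated F → m Data.Nat.≤ size F)
  where import Relation.Binary.PropositionalEquality
        import Data.Nat

{-# OPTIONS --safe #-}
module Submission where

-- An induced N in a family F ⊆ P([n]) is exactly an induced path P4 of its comparability graph, so an
-- N-saturated F is a maximal P4-free family. Lower bound: for every coordinate i, F contains a pair
-- A ⊂ A ∪ {i}. Otherwise descend through autonomous subsets of F (modules of the inclusion order): by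
-- Seinsche's theorem each either splits into mutually incomparable parts or has an element comparable to
-- all of it, and following a pair of sets that disagree on i shrinks the autonomous set until no such
-- pair is left; then toggling i in the set just below it yields a set that can be added to F without
-- creating an N. Sending i to the bottom of its edge, or to the top when that bottom carries a second
-- edge, is injective (two edges with a common top and a further edge form a P4), so n ≤ 2|F|.
-- Upper bound: the prefixes {0, …, k - 1} together with all singletons are N-saturated.

open import Level using (0ℓ)
open import Function using (_∘_; _$_; id)
open import Data.Empty using (⊥; ⊥-elim)
open import Data.Product using (Σ; ∃; _×_; _,_; proj₁; proj₂; uncurry)
import Data.Product as Product
open import Data.Sum using (_⊎_; inj₁; inj₂; [_,_]′)
import Data.Sum as Sum
open import Data.Sum.Properties using (inj₁-injective; inj₂-injective)
open import Data.Bool using () renaming (_≟_ to _≟ᵇ_)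
open import Data.Nat using (ℕ; zero; suc; _≤_; _<_; _+_; _*_; _≥_; z≤n; s≤s; s≤s⁻¹)
open import Data.Nat.Properties
  using (m≤n⇒m≤1+n; ≤-trans; ≤-total; n≮0; <-irrefl; <⇒≤; suc-injective; ≮⇒≥; +-identityʳ; +-monoˡ-≤)
open import Data.Nat.Induction using (<-wellFounded)
open import Data.Fin using (Fin; zero; suc; toℕ; join; splitAt) renaming (_≤_ to _≤ᶠ_; _<_ to _<ᶠ_)
open import Data.Fin.Properties using (any?; injective⇒≤; splitAt-join; toℕ<n)
  renaming (_≟_ to _≟ᶠ_; _<?_ to _<ᶠ?_; ≤∧≢⇒< to ≤ᶠ∧≢⇒<ᶠ; <⇒≢ to <ᶠ⇒≢)
open import Data.Vec using ([]; _∷_; here; there)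
open import Data.Vec.Properties using (≡-dec)
open import Data.Fin.Subset
  using (Subset; _∈_; _∉_; _⊆_; _⊂_; ⊤; _∪_; _∩_; ∁; ⁅_⁆; ⋃; ⋂; inside; outside; Nonempty) renaming (⊥ to ∅)
open import Data.Fin.Subset.Properties
  using (_∈?_; _⊆?_; _⊂?_; anySubset?; nonempty?; ⊆-refl; ⊆-reflexive; ⊆-trans; ⊆-antisym; ⊂-irref; ⊂-trans;
         ⊂-⊆-trans; ⊆-⊂-trans; ⊥⊆; ⊆⊤; ∉⊥; ∈⊤; p⊆p∪q; q⊆p∪q; x∈p∪q⁻; p∩q⊆p; p∩q⊆q; x∈p∩q⁺; x∈p∩q⁻;
         x∈⁅x⁆; x∈⁅y⁆⇒x≡y; x≢y⇒x∉⁅y⁆; x∉⁅y⁆⇒x≢y; x∈∁p⇒x∉p; x∉p⇒x∈∁p)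
open import Data.List using (List; []; _∷_; length; filter; lookup; _++_; applyUpTo; tabulate; deduplicate)
open import Data.List.Properties using (length-++; length-applyUpTo; length-tabulate; length-deduplicate)
open import Data.List.Membership.Propositional using () renaming (_∈_ to _∈ₗ_)
import Data.List.Membership.Propositional as Membership
open import Data.List.Membership.Propositional.Properties
  using (∈-filter⁺; ∈-filter⁻; ∈-++⁺ˡ; ∈-++⁺ʳ; ∈-++⁻; ∈-applyUpTo⁺; ∈-applyUpTo⁻; ∈-tabulate⁺; ∈-tabulate⁻;
         ∈-deduplicate⁺; ∈-deduplicate⁻)
open import Data.List.Membership.DecPropositional using () renaming (_∈?_ to ∈ₗ?)
open import Data.List.Relation.Unary.Any using (Any; here; there; index)
import Data.List.Relation.Unary.Any as Any
open import Data.List.Relation.Unary.Any.Properties using (lookup-index)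
open import Data.List.Relation.Unary.AllPairs using (allPairs?)
open import Data.List.Relation.Unary.Unique.DecPropositional.Properties using (deduplicate-!)
open import Relation.Nullary using (¬_; Dec; yes; no; contradiction)
open import Relation.Nullary.Decidable using (_×-dec_; _⊎-dec_; _→-dec_; ¬?; map′; decidable-stable)
open import Relation.Unary using (Pred; Decidable)
import Relation.Unary as U
open import Relation.Unary.Properties using (_∩?_; _∪?_; ∁?)
open import Relation.Binary using (Rel; DecidableEquality) renaming (Decidable to Decidable₂)
open import Relation.Binary.PropositionalEquality using (_≡_; _≢_; refl; sym; trans; cong; cong₂; subst; ≢-sym)
open import Induction.WellFounded using (WellFounded; Acc; acc; module Subrelation)
import Relation.Binary.Construct.On as On
open import Defs

module _ {A : Set} {P Q : Pred A 0ℓ} (P? : Decidable P) (Q? : Decidable Q) where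

  length-filter-mono : ∀ xs → (∀ {x} → x ∈ₗ xs → P x → Q x) → length (filter P? xs) ≤ length (filter Q? xs)
  length-filter-mono [] _ = z≤n
  length-filter-mono (x ∷ xs) P⇒Q with P? x | Q? x | length-filter-mono xs (P⇒Q ∘ there)
  ... | yes _  | yes _  | rec = s≤s rec
  ... | yes px | no ¬qx | _   = contradiction (P⇒Q (here refl) px) ¬qx
  ... | no _   | yes _  | rec = m≤n⇒m≤1+n rec
  ... | no _   | no _   | rec = rec

  length-filter-< : ∀ xs → (∀ {x} → x ∈ₗ xs → P x → Q x) → Any (λ x → Q x × ¬ P x) xs →
                    length (filter P? xs) < length (filter Q? xs)
  length-filter-< (x ∷ xs) P⇒Q (here (qx , ¬px)) with P? x | Q? x
  ... | yes px | _      = contradiction px ¬px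
  ... | no _   | yes _  = s≤s (length-filter-mono xs (P⇒Q ∘ there))
  ... | no _   | no ¬qx = contradiction qx ¬qx
  length-filter-< (x ∷ xs) P⇒Q (there w) with P? x | Q? x | length-filter-< xs (P⇒Q ∘ there) w
  ... | yes _  | yes _  | rec = s≤s rec
  ... | yes px | no ¬qx | _   = contradiction (P⇒Q (here refl) px) ¬qx
  ... | no _   | yes _  | rec = m≤n⇒m≤1+n rec
  ... | no _   | no _   | rec = rec

module Regions {V : Set} (_≟_ : DecidableEquality V) (G : List V) where

  infixr 7 _∩ᴿ_
  infixr 6 _∪ᴿ_

  -- Regions are syntax rather than predicates so that Agda can recover them by unification.
  data Region : Set₁ where
    region    : (P : Pred V 0ℓ) → Decidable P → Region
    _∩ᴿ_ _∪ᴿ_ : Region → Region → Region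
    ∁ᴿ        : Region → Region

  Holds : Region → Pred V 0ℓ
  Holds (region P _) = P
  Holds (K ∩ᴿ L)     = Holds K U.∩ Holds L
  Holds (K ∪ᴿ L)     = Holds K U.∪ Holds L
  Holds (∁ᴿ K)       = U.∁ (Holds K)

  holds? : (K : Region) → Decidable (Holds K)
  holds? (region _ P?) = P?
  holds? (K ∩ᴿ L)      = holds? K ∩? holds? L
  holds? (K ∪ᴿ L)      = holds? K ∪? holds? L
  holds? (∁ᴿ K)        = ∁? (holds? K)

  infix 4 _∈ᴿ_
  infixr 4 _,_
  record _∈ᴿ_ (x : V) (K : Region) : Set where
    constructor _,_
    field
      ∈G    : x ∈ₗ G
      holds : Holds K x
  open _∈ᴿ_ public

  infixl 5 _∖ᴿ_ _─ᴿ_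

  ｛_｝ᴿ : V → Region
  ｛ v ｝ᴿ = region (_≡ v) (_≟ v)

  _∖ᴿ_ : Region → Region → Region
  K ∖ᴿ L = K ∩ᴿ ∁ᴿ L

  _─ᴿ_ : Region → V → Region
  K ─ᴿ v = K ∖ᴿ ｛ v ｝ᴿ

  anyᴿ? : (K : Region) {P : Pred V 0ℓ} → Decidable P → Dec (∃ λ x → x ∈ᴿ K × P x)
  anyᴿ? K {P} P? = map′ found lost (Any.any? (holds? K ∩? P?) G)
    where
    found : Any (Holds K U.∩ P) G → ∃ λ x → x ∈ᴿ K × P x
    found w with Membership.find w
    ... | x , x∈G , Kx , px = x , (x∈G , Kx) , px
    lost : (∃ λ x → x ∈ᴿ K × P x) → Any (Holds K U.∩ P) G
    lost (x , (x∈G , Kx) , px) = Membership.lose x∈G (Kx , px)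

  count : Region → ℕ
  count K = length (filter (holds? K) G)

  infix 4 _⊰_
  -- A record rather than an alias, again so that L and K can be inferred.
  record _⊰_ (L K : Region) : Set where
    constructor smaller
    field count-< : count L < count K

  ⊰-wellFounded : WellFounded _⊰_
  ⊰-wellFounded = Subrelation.wellFounded _⊰_.count-< (On.wellFounded count <-wellFounded)

  _∈ᴿ?_ : ∀ x K → Dec (x ∈ᴿ K)
  x ∈ᴿ? K = map′ (uncurry _,_) (λ (x∈G , Kx) → x∈G , Kx) (∈ₗ? _≟_ x G ×-dec holds? K x)

  ∈∩ : ∀ {K L x} → x ∈ᴿ K → Holds L x → x ∈ᴿ K ∩ᴿ L
  ∈∩ (x∈G , Kx) Lx = x∈G , (Kx , Lx)

  ∩-left : ∀ {K L x} → x ∈ᴿ K ∩ᴿ L → x ∈ᴿ K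
  ∩-left (x∈G , (Kx , _)) = x∈G , Kx

  shrink : ∀ {K L x} → (∀ {y} → y ∈ᴿ L → Holds K y) → x ∈ᴿ K → ¬ Holds L x → L ⊰ K
  shrink {K} {L} L⊆K (x∈G , Kx) ¬Lx = smaller $
    length-filter-< (holds? L) (holds? K) G (λ y∈G → L⊆K ∘ (y∈G ,_)) (Membership.lose x∈G (Kx , ¬Lx))

  ∩⊰ : ∀ {K S x} → x ∈ᴿ K ∖ᴿ S → K ∩ᴿ S ⊰ K
  ∩⊰ (x∈G , (Kx , x∉S)) = shrink (proj₁ ∘ holds) (x∈G , Kx) (x∉S ∘ proj₂)

-- Seinsche's theorem: a P4-free graph splits or cosplits

module P4FreeGraphs {V : Set} (_≟_ : DecidableEquality V) (G : List V) where
  open Regions _≟_ G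

  record P4FreeGraph : Set₁ where
    field
      _~_ _≁_ : Rel V 0ℓ
      _~?_    : Decidable₂ _~_
      _≁?_    : Decidable₂ _≁_
      ~-sym   : ∀ {x y} → x ~ y → y ~ x
      ≁-sym   : ∀ {x y} → x ≁ y → y ≁ x
      ~⇒¬≁    : ∀ {x y} → x ~ y → ¬ x ≁ y
      ~⊎≁     : ∀ {x y} → x ≢ y → x ~ y ⊎ x ≁ y
      p4-free : ∀ {a b c d} → a ∈ₗ G → b ∈ₗ G → c ∈ₗ G → d ∈ₗ G →
                a ~ b → b ~ c → c ~ d → a ≁ c → b ≁ d → a ≁ d → ⊥

  complement : P4FreeGraph → P4FreeGraph
  complement g = record
    { _~_ = _≁_ ; _≁_ = _~_ ; _~?_ = _≁?_ ; _≁?_ = _~?_ ; ~-sym = ≁-sym ; ≁-sym = ~-sym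
    ; ~⇒¬≁ = λ x≁y x~y → ~⇒¬≁ x~y x≁y
    ; ~⊎≁ = Sum.swap ∘ ~⊎≁
    ; p4-free = λ a∈ b∈ c∈ d∈ a≁b b≁c c≁d a~c b~d a~d →
        p4-free c∈ a∈ d∈ b∈ (~-sym a~c) a~d (~-sym b~d) c≁d a≁b (≁-sym b≁c) }
    where open P4FreeGraph g

  Across : Rel V 0ℓ → Region → Region → Set
  Across _⋈_ K S = ∀ {x y} → x ∈ᴿ K ∩ᴿ S → y ∈ᴿ K ∖ᴿ S → x ⋈ y

  Across-∁ : ∀ {_⋈_ : Rel V 0ℓ} {K S} → (∀ {x y} → x ⋈ y → y ⋈ x) → Across _⋈_ K S → Across _⋈_ K (∁ᴿ S)
  Across-∁ {S = S} ⋈-sym across (x∈G , (Kx , x∉S)) (y∈G , (Ky , y∉∁S)) =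
    ⋈-sym (across (y∈G , (Ky , decidable-stable (holds? S _) y∉∁S)) (x∈G , (Kx , x∉S)))

  record Split (_⋈_ : Rel V 0ℓ) (K : Region) : Set₁ where
    constructor split
    field
      side   : Region
      {a b}  : V
      a∈     : a ∈ᴿ K ∩ᴿ side
      b∈     : b ∈ᴿ K ∖ᴿ side
      across : Across _⋈_ K side

  module Extension (g : P4FreeGraph) {K : Region} {v : V} (v∈K : v ∈ᴿ K) where
    open P4FreeGraph g

    private
      K′ : Region
      K′ = K ─ᴿ v

      v~ : Region
      v~ = region (v ~_) (v ~?_)

      ≁v : ∀ {x} → x ≢ v → ¬ v ~ x → x ≁ v
      ≁v x≢v ¬v~x = Sum.[ ⊥-elim ∘ ¬v~x ∘ ~-sym , id ]′ (~⊎≁ x≢v)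

      Bridge : Region → V → Set
      Bridge S p = v ~ p × ∃ λ q → q ∈ᴿ K′ ∩ᴿ S × ¬ v ~ q × p ~ q

      bridge? : (S : Region) → Decidable (Bridge S)
      bridge? S p = v ~? p ×-dec anyᴿ? (K′ ∩ᴿ S) (λ q → ¬? (v ~? q) ×-dec p ~? q)

      across-─v : ∀ {S} → Across _≁_ K′ S → (∀ {x} → x ∈ᴿ K′ ∩ᴿ S → ¬ v ~ x) → Across _≁_ K (S ─ᴿ v)
      across-─v across ¬v~S {x} {y} (x∈G , (Kx , (Sx , x≢v))) (y∈G , (Ky , y∉S─v)) with y ≟ v
      ... | yes refl = ≁v x≢v (¬v~S (x∈G , ((Kx , x≢v) , Sx)))
      ... | no y≢v   = across (x∈G , ((Kx , x≢v) , Sx)) (y∈G , ((Ky , y≢v) , y∉S─v ∘ (_, y≢v)))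

      across-∪v : ∀ {S} → Across _≁_ K′ S → (∀ {y} → y ∈ᴿ K′ ∖ᴿ S → ¬ v ~ y) → Across _≁_ K (S ∪ᴿ ｛ v ｝ᴿ)
      across-∪v across ¬v~K′∖S {x} {y} (x∈G , (Kx , x∈S∪v)) (y∈G , (Ky , y∉S∪v)) with x ≟ v
      ... | yes refl = ≁-sym (≁v y≢v (¬v~K′∖S (y∈G , ((Ky , y≢v) , y∉S∪v ∘ inj₁))))
        where
        y≢v : y ≢ v
        y≢v = y∉S∪v ∘ inj₂
      ... | no x≢v   = across (x∈G , ((Kx , x≢v) , [ id , ⊥-elim ∘ x≢v ]′ x∈S∪v))
                              (y∈G , ((Ky , y∉S∪v ∘ inj₂) , y∉S∪v ∘ inj₁))

    -- The neighbours of v are removed from the side S of a ≁-split of K′ until none is left, or until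
    -- one of them (a bridge) is adjacent to a remaining non-neighbour of v; then v joins S.
    refine : (S : Region) → Acc _⊰_ (K′ ∩ᴿ S) → ∀ {u b} → u ∈ᴿ K′ ∩ᴿ S → v ≁ u → b ∈ᴿ K′ ∖ᴿ S →
             Across _≁_ K′ S → Split _≁_ K
    refine S (acc rs) (u∈G , ((Ku , u≢v) , Su)) v≁u (b∈G , ((Kb , b≢v) , b∉S)) across
      with anyᴿ? (K′ ∩ᴿ S) (v ~?_)
    ... | no no-neighbour =
          split (S ─ᴿ v) (u∈G , (Ku , (Su , u≢v))) (b∈G , (Kb , b∉S ∘ proj₁))
                (across-─v across λ x∈ v~x → no-neighbour (_ , x∈ , v~x))
    ... | yes (x₀ , x₀∈K′S , v~x₀) with anyᴿ? (K′ ∩ᴿ S) (bridge? S)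
    ...   | yes (p , p∈K′S , v~p , q , q∈K′S@(_ , ((_ , q≢v) , _)) , ¬v~q , p~q)
              with anyᴿ? (K′ ∖ᴿ S) (v ~?_)
    ...     | yes (y , y∈K′∖S , v~y) =
                ⊥-elim (p4-free (∈G q∈K′S) (∈G p∈K′S) (∈G v∈K) (∈G y∈K′∖S) (~-sym p~q) (~-sym v~p) v~y
                                (≁v q≢v ¬v~q) (across p∈K′S y∈K′∖S) (across q∈K′S y∈K′∖S))
    ...     | no no-outer-neighbour =
                split (S ∪ᴿ ｛ v ｝ᴿ) (u∈G , (Ku , inj₁ Su)) (b∈G , (Kb , [ b∉S , b≢v ]′))
                      (across-∪v across λ y∈ v~y → no-outer-neighbour (_ , y∈ , v~y))
    refine S (acc rs) (u∈G , (K′u , Su)) v≁u (b∈G , (K′b , b∉S)) across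
      | yes (x₀ , x₀∈K′S , v~x₀) | no no-bridge =
        refine (S ∩ᴿ ∁ᴿ v~) (rs S″⊰S) (u∈G , (K′u , (Su , λ v~u → ~⇒¬≁ v~u v≁u))) v≁u
               (b∈G , (K′b , b∉S ∘ proj₁)) across″
      where
      S″⊰S : K′ ∩ᴿ (S ∩ᴿ ∁ᴿ v~) ⊰ K′ ∩ᴿ S
      S″⊰S = shrink (λ (_ , (K′y , (Sy , _))) → K′y , Sy) x₀∈K′S (λ (_ , (_ , ¬v~x₀)) → ¬v~x₀ v~x₀)
      across″ : Across _≁_ K′ (S ∩ᴿ ∁ᴿ v~)
      across″ {x} {y} (x∈G , (K′x , (Sx , ¬v~x))) (y∈G , (K′y , y∉S″)) with holds? S y | v ~? y
      ... | no y∉S  | _       = across (x∈G , (K′x , Sx)) (y∈G , (K′y , y∉S))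
      ... | yes Sy  | no ¬v~y = ⊥-elim (y∉S″ (Sy , ¬v~y))
      ... | yes Sy  | yes v~y with ~⊎≁ (λ x≡y → ¬v~x (subst (v ~_) (sym x≡y) v~y))
      ...   | inj₁ x~y =
              ⊥-elim (no-bridge (y , (y∈G , (K′y , Sy)) , v~y , x , (x∈G , (K′x , Sx)) , ¬v~x , ~-sym x~y))
      ...   | inj₂ x≁y = x≁y

    extend : Split _≁_ K′ → Split _≁_ K ⊎ Split _~_ K
    extend (split S {a} a∈@(a∈G , ((Ka , a≢v) , Sa)) b∈ across) with anyᴿ? K′ (v ≁?_)
    ... | no no-non-neighbour = inj₂ (split ｛ v ｝ᴿ (∈∩ v∈K refl) (a∈G , (Ka , a≢v)) across′)
      where
      across′ : Across _~_ K ｛ v ｝ᴿ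
      across′ (_ , (_ , refl)) (y∈G , (Ky , y≢v)) =
        Sum.[ id , (λ v≁y → ⊥-elim (no-non-neighbour (_ , (y∈G , (Ky , y≢v)) , v≁y))) ]′ (~⊎≁ (y≢v ∘ sym))
    ... | yes (u , u∈K′ , v≁u) with holds? S u
    ...   | yes Su  = inj₁ (refine S (⊰-wellFounded _) (∈∩ u∈K′ Su) v≁u b∈ across)
    ...   | no u∉S = inj₁ (refine (∁ᴿ S) (⊰-wellFounded _) (∈∩ u∈K′ u∉S) v≁u (a∈G , ((Ka , a≢v) , λ a∉S → a∉S Sa))
                                  (Across-∁ ≁-sym across))

  seinsche : (g : P4FreeGraph) (let open P4FreeGraph g) → ∀ {K x y} → x ∈ᴿ K → y ∈ᴿ K → x ≢ y →
             Split _≁_ K ⊎ Split _~_ K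
  seinsche g {K} x∈K y∈K x≢y = go (⊰-wellFounded K) x∈K y∈K x≢y
    where
    open P4FreeGraph g
    go : ∀ {K x y} → Acc _⊰_ K → x ∈ᴿ K → y ∈ᴿ K → x ≢ y → Split _≁_ K ⊎ Split _~_ K
    go {K} {x} {y} (acc rs) x∈K y∈K x≢y with anyᴿ? (K ─ᴿ x) (λ z → ¬? (z ≟ y))
    ... | no only-two = Sum.map (split ｛ x ｝ᴿ (∈∩ x∈K refl) (∈∩ y∈K (x≢y ∘ sym)) ∘ across-pair)
                               (split ｛ x ｝ᴿ (∈∩ x∈K refl) (∈∩ y∈K (x≢y ∘ sym)) ∘ across-pair)
                               (Sum.swap (~⊎≁ x≢y))
      where
      across-pair : ∀ {_⋈_ : Rel V 0ℓ} → x ⋈ y → Across _⋈_ K ｛ x ｝ᴿ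
      across-pair x⋈y (_ , (_ , refl)) (b∈G , (Kb , b≢x))
        rewrite decidable-stable (_ ≟ y) (λ b≢y → only-two (_ , (b∈G , (Kb , b≢x)) , b≢y)) = x⋈y
    ... | yes (z , z∈K─x , z≢y) with go (rs (shrink (proj₁ ∘ holds) x∈K (λ (_ , x≢x) → x≢x refl)))
                                       (∈∩ y∈K (x≢y ∘ sym)) z∈K─x (z≢y ∘ sym)
    ...   | inj₁ sp = Extension.extend g x∈K sp
    ...   | inj₂ sp = Sum.swap (Extension.extend (complement g) x∈K sp)

private variable
  n : ℕ
  a b c d x y z : Subset n

_≟ˢ_ : DecidableEquality (Subset n)
_≟ˢ_ = ≡-dec _≟ᵇ_

∈F? : (F : Family n) → ∀ X → Dec (X ∈F F)
∈F? F X = ∈ₗ? _≟ˢ_ X (members F)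

⊈⇒∃ : ¬ x ⊆ y → ∃ λ e → e ∈ x × e ∉ y
⊈⇒∃ {x = x} {y} x⊈y with any? (λ e → e ∈? x ×-dec ¬? (e ∈? y))
... | yes witness = witness
... | no none = contradiction (λ {e} e∈x → decidable-stable (e ∈? y) (λ e∉y → none (e , e∈x , e∉y))) x⊈y

⊆∧≢⇒⊂ : x ⊆ y → x ≢ y → x ⊂ y
⊆∧≢⇒⊂ x⊆y x≢y = x⊆y , ⊈⇒∃ (λ y⊆x → x≢y (⊆-antisym x⊆y y⊆x))

⊂⇒≢ : x ⊂ y → x ≢ y
⊂⇒≢ x⊂y x≡y = ⊂-irref x≡y x⊂y

Comparable : Subset n → Subset n → Set
Comparable x y = x ⊆ y ⊎ y ⊆ x

Adj : Subset n → Subset n → Set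
Adj x y = x ⊂ y ⊎ y ⊂ x

Incomparable⇒≢ : Incomparable x y → x ≢ y
Incomparable⇒≢ (x⊈y , _) refl = x⊈y ⊆-refl

Incomparable-sym : Incomparable x y → Incomparable y x
Incomparable-sym = Product.swap

Adj-sym : Adj x y → Adj y x
Adj-sym = Sum.swap

Adj⇒≢ : Adj x y → x ≢ y
Adj⇒≢ (inj₁ x⊂y) = ⊂⇒≢ x⊂y
Adj⇒≢ (inj₂ y⊂x) = ⊂⇒≢ y⊂x ∘ sym

Adj⇒Comparable : Adj x y → Comparable x y
Adj⇒Comparable = Sum.map proj₁ proj₁

Comparable-sym : Comparable x y → Comparable y x
Comparable-sym = Sum.swap

Comparable⇒¬Incomparable : Comparable x y → ¬ Incomparable x y
Comparable⇒¬Incomparable (inj₁ x⊆y) (x⊈y , _) = x⊈y x⊆y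
Comparable⇒¬Incomparable (inj₂ y⊆x) (_ , y⊈x) = y⊈x y⊆x

Adj⇒¬Incomparable : Adj x y → ¬ Incomparable x y
Adj⇒¬Incomparable = Comparable⇒¬Incomparable ∘ Adj⇒Comparable

Incomparable? : (x y : Subset n) → Dec (Incomparable x y)
Incomparable? x y = ¬? (x ⊆? y) ×-dec ¬? (y ⊆? x)

Adj? : (x y : Subset n) → Dec (Adj x y)
Adj? x y = (x ⊂? y) ⊎-dec (y ⊂? x)

Adj⊎Incomparable : x ≢ y → Adj x y ⊎ Incomparable x y
Adj⊎Incomparable {x = x} {y} x≢y with x ⊆? y | y ⊆? x
... | yes x⊆y | _ = inj₁ (inj₁ (⊆∧≢⇒⊂ x⊆y x≢y))
... | no _ | yes y⊆x = inj₁ (inj₂ (⊆∧≢⇒⊂ y⊆x (x≢y ∘ sym)))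
... | no x⊈y | no y⊈x = inj₂ (x⊈y , y⊈x)

P4 : Subset n → Subset n → Subset n → Subset n → Set
P4 a b c d = Adj a b × Adj b c × Adj c d × Incomparable a c × Incomparable b d × Incomparable a d

induced-N : a ⊂ c → b ⊂ c → b ⊂ d → Incomparable a b → Incomparable a d → Incomparable c d →
            InducedN a b c d
induced-N a⊂c b⊂c b⊂d ab ad cd =
  Incomparable⇒≢ ab , ⊂⇒≢ a⊂c , Incomparable⇒≢ ad , ⊂⇒≢ b⊂c , ⊂⇒≢ b⊂d , Incomparable⇒≢ cd ,
  a⊂c , b⊂c , b⊂d , ab , ad , cd

N⇒P4 : InducedN a b c d → P4 a c b d
N⇒P4 (_ , _ , _ , _ , _ , _ , a⊂c , b⊂c , b⊂d , ab , ad , cd) = inj₁ a⊂c , inj₂ b⊂c , inj₁ b⊂d , ab , cd , ad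

-- Inclusion is transitive, so the middle edge of an induced P4 points against both outer ones.
P4⇒N : P4 a b c d → InducedN a c b d ⊎ InducedN d b c a
P4⇒N (inj₁ a⊂b , inj₁ b⊂c , _ , (a⊈c , _) , _ , _) = ⊥-elim (a⊈c (⊆-trans (proj₁ a⊂b) (proj₁ b⊂c)))
P4⇒N (inj₁ a⊂b , inj₂ c⊂b , inj₁ c⊂d , ac , bd , ad) = inj₁ (induced-N a⊂b c⊂b c⊂d ac ad bd)
P4⇒N (inj₁ _ , inj₂ c⊂b , inj₂ d⊂c , _ , (_ , d⊈b) , _) = ⊥-elim (d⊈b (⊆-trans (proj₁ d⊂c) (proj₁ c⊂b)))
P4⇒N (inj₂ b⊂a , inj₂ c⊂b , _ , (_ , c⊈a) , _ , _) = ⊥-elim (c⊈a (⊆-trans (proj₁ c⊂b) (proj₁ b⊂a)))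
P4⇒N (inj₂ _ , inj₁ b⊂c , inj₁ c⊂d , _ , (b⊈d , _) , _) = ⊥-elim (b⊈d (⊆-trans (proj₁ b⊂c) (proj₁ c⊂d)))
P4⇒N (inj₂ b⊂a , inj₁ b⊂c , inj₂ d⊂c , ac , bd , ad) =
  inj₂ (induced-N d⊂c b⊂c b⊂a (Incomparable-sym bd) (Incomparable-sym ad) (Incomparable-sym ac))

P4Free : (Subset n → Set) → Set
P4Free Mem = ∀ {a b c d} → Mem a → Mem b → Mem c → Mem d → ¬ P4 a b c d

module _ {Mem : Subset n → Set} where

  N-free⇒P4Free : ¬ ContainsN Mem → P4Free Mem
  N-free⇒P4Free noN ma mb mc md p4 with P4⇒N p4
  ... | inj₁ N = noN (_ , _ , _ , _ , ma , mc , mb , md , N)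
  ... | inj₂ N = noN (_ , _ , _ , _ , md , mb , mc , ma , N)

  P4Free⇒N-free : P4Free Mem → ¬ ContainsN Mem
  P4Free⇒N-free free (_ , _ , _ , _ , mP , mQ , mR , mS , N) = free mP mR mQ mS (N⇒P4 N)

P4Free-mono : ∀ {Mem Mem′ : Subset n → Set} → (∀ {v} → Mem v → Mem′ v) → P4Free Mem′ → P4Free Mem
P4Free-mono Mem⊆Mem′ free ma mb mc md = free (Mem⊆Mem′ ma) (Mem⊆Mem′ mb) (Mem⊆Mem′ mc) (Mem⊆Mem′ md)

-- A vertex comparable to all others has no non-neighbour, so it lies on no induced P4.
P4Free-∪-comparable : ∀ {Mem : Subset n → Set} {X} → (∀ {v} → Mem v → Comparable X v) →
                       P4Free Mem → P4Free (λ v → Mem v ⊎ v ≡ X)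
P4Free-∪-comparable {Mem = Mem} {X} X∼ free {a} {b} {c} {d} ma mb mc md p4@(_ , _ , _ , ac , bd , _) =
  go ma mb mc md
  where
  non-neighbour : ∀ {u w} → u ≡ X → Mem w ⊎ w ≡ X → ¬ Incomparable u w
  non-neighbour refl (inj₂ refl) X∥X = Incomparable⇒≢ X∥X refl
  non-neighbour refl (inj₁ mw) (X⊈w , w⊈X) = Sum.[ X⊈w , w⊈X ]′ (X∼ mw)
  go : Mem a ⊎ a ≡ X → Mem b ⊎ b ≡ X → Mem c ⊎ c ≡ X → Mem d ⊎ d ≡ X → ⊥
  go (inj₂ a≡X) _ mc _ = non-neighbour a≡X mc ac
  go _ (inj₂ b≡X) _ md = non-neighbour b≡X md bd
  go ma _ (inj₂ c≡X) _ = non-neighbour c≡X ma (Incomparable-sym ac)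
  go _ mb _ (inj₂ d≡X) = non-neighbour d≡X mb (Incomparable-sym bd)
  go (inj₁ ma) (inj₁ mb) (inj₁ mc) (inj₁ md) = free ma mb mc md p4

IsModule : (Subset n → Set) → (Subset n → Set) → Set
IsModule Mem I = ∀ {w p q} → Mem w → ¬ I w → I p → I q → Adj w p → Adj w q

module _ {Mem I : Subset n → Set} {m₀ : Subset n} (I-module : IsModule Mem I) (Im₀ : I m₀) where
  private
    outside-I : ∀ {v} → Mem v → ¬ I v → (Mem v × ¬ I v) ⊎ v ≡ m₀
    outside-I mv ¬iv = inj₁ (mv , ¬iv)
    apart : ∀ {w p q} → Mem w → ¬ I w → I p → I q → Adj w p → Incomparable w q → ⊥
    apart mw ¬iw ip iq w~p = Adj⇒¬Incomparable (I-module mw ¬iw ip iq w~p)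
    to-m₀ : ∀ {w p} → Mem w → ¬ I w → I p → Adj w p → Adj w m₀
    to-m₀ mw ¬iw ip = I-module mw ¬iw ip Im₀
    to-m₀′ : ∀ {w p} → Mem w → ¬ I w → I p → Incomparable w p → Incomparable w m₀
    to-m₀′ {w} mw ¬iw ip w∥p = Sum.[ (λ w~m₀ → ⊥-elim (apart mw ¬iw Im₀ ip w~m₀ w∥p)) , id ]′
                                   (Adj⊎Incomparable λ { refl → ¬iw Im₀ })

  -- An induced P4 meeting a module in two or three vertices would have an outside vertex telling two of
  -- them apart; so it lies within the module or meets it at most once, and then survives collapsing it.
  P4Free-substitution : (∀ v → Dec (I v)) → P4Free (λ v → Mem v × I v) →
                          P4Free (λ v → (Mem v × ¬ I v) ⊎ v ≡ m₀) → P4Free Mem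
  P4Free-substitution I? within quotient {a} {b} {c} {d} ma mb mc md p4@(ab , bc , cd , ac , bd , ad)
    with I? a | I? b | I? c | I? d
  ... | yes ia | yes ib | yes ic | yes id = within (ma , ia) (mb , ib) (mc , ic) (md , id) p4
  ... | yes ia | yes ib | yes ic | no id  = apart md id ic ib (Adj-sym cd) (Incomparable-sym bd)
  ... | yes ia | yes ib | no ic  | yes id = apart mc ic ib ia (Adj-sym bc) (Incomparable-sym ac)
  ... | yes ia | no ib  | yes ic | yes id = apart mb ib ia id (Adj-sym ab) bd
  ... | no ia  | yes ib | yes ic | yes id = apart ma ia ib ic ab ac
  ... | yes ia | yes ib | no ic  | no id  = apart mc ic ib ia (Adj-sym bc) (Incomparable-sym ac)
  ... | yes ia | no ib  | yes ic | no id  = apart md id ic ia (Adj-sym cd) (Incomparable-sym ad)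
  ... | yes ia | no ib  | no ic  | yes id = apart mb ib ia id (Adj-sym ab) bd
  ... | no ia  | yes ib | yes ic | no id  = apart ma ia ib ic ab ac
  ... | no ia  | yes ib | no ic  | yes id = apart ma ia ib id ab ad
  ... | no ia  | no ib  | yes ic | yes id = apart mb ib ic id bc bd
  ... | no ia  | no ib  | no ic  | no id  =
    quotient (outside-I ma ia) (outside-I mb ib) (outside-I mc ic) (outside-I md id) p4
  ... | yes ia | no ib  | no ic  | no id  =
    quotient (inj₂ refl) (outside-I mb ib) (outside-I mc ic) (outside-I md id)
             (Adj-sym (to-m₀ mb ib ia (Adj-sym ab)) , bc , cd ,
              Incomparable-sym (to-m₀′ mc ic ia (Incomparable-sym ac)) , bd ,
              Incomparable-sym (to-m₀′ md id ia (Incomparable-sym ad)))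
  ... | no ia  | yes ib | no ic  | no id  =
    quotient (outside-I ma ia) (inj₂ refl) (outside-I mc ic) (outside-I md id)
             (to-m₀ ma ia ib ab , Adj-sym (to-m₀ mc ic ib (Adj-sym bc)) , cd , ac ,
              Incomparable-sym (to-m₀′ md id ib (Incomparable-sym bd)) , ad)
  ... | no ia  | no ib  | yes ic | no id  =
    quotient (outside-I ma ia) (outside-I mb ib) (inj₂ refl) (outside-I md id)
             (ab , to-m₀ mb ib ic bc , Adj-sym (to-m₀ md id ic (Adj-sym cd)) , to-m₀′ ma ia ic ac , bd , ad)
  ... | no ia  | no ib  | no ic  | yes id =
    quotient (outside-I ma ia) (outside-I mb ib) (outside-I mc ic) (inj₂ refl)
             (ab , bc , to-m₀ mc ic id cd , ac , to-m₀′ mb ib id bd , to-m₀′ ma ia id ad)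

data Dir : Set where
  up down : Dir

opposite : Dir → Dir
opposite up   = down
opposite down = up

infix 4 _≤[_]_ _<[_]_
_≤[_]_ _<[_]_ : Subset n → Dir → Subset n → Set
x ≤[ up ]   y = x ⊆ y
x ≤[ down ] y = y ⊆ x
x <[ up ]   y = x ⊂ y
x <[ down ] y = y ⊂ x

≤ᵈ-refl : ∀ d → x ≤[ d ] x
≤ᵈ-refl up   = ⊆-refl
≤ᵈ-refl down = ⊆-refl

≤ᵈ-trans : ∀ d → x ≤[ d ] y → y ≤[ d ] z → x ≤[ d ] z
≤ᵈ-trans up   x⊆y y⊆z = ⊆-trans x⊆y y⊆z
≤ᵈ-trans down y⊆x z⊆y = ⊆-trans z⊆y y⊆x

≤ᵈ-antisym : ∀ d → x ≤[ d ] y → y ≤[ d ] x → x ≡ y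
≤ᵈ-antisym up   x⊆y y⊆x = ⊆-antisym x⊆y y⊆x
≤ᵈ-antisym down y⊆x x⊆y = ⊆-antisym x⊆y y⊆x

<ᵈ-trans : ∀ d → x <[ d ] y → y <[ d ] z → x <[ d ] z
<ᵈ-trans up   x⊂y y⊂z = ⊂-trans x⊂y y⊂z
<ᵈ-trans down y⊂x z⊂y = ⊂-trans z⊂y y⊂x

≤ᵈ-<ᵈ-trans : ∀ d → x ≤[ d ] y → y <[ d ] z → x <[ d ] z
≤ᵈ-<ᵈ-trans up   x⊆y y⊂z = ⊆-⊂-trans x⊆y y⊂z
≤ᵈ-<ᵈ-trans down y⊆x z⊂y = ⊂-⊆-trans z⊂y y⊆x

<ᵈ-≤ᵈ-trans : ∀ d → x <[ d ] y → y ≤[ d ] z → x <[ d ] z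
<ᵈ-≤ᵈ-trans up   x⊂y y⊆z = ⊂-⊆-trans x⊂y y⊆z
<ᵈ-≤ᵈ-trans down y⊂x z⊆y = ⊆-⊂-trans z⊆y y⊂x

<ᵈ⇒≤ᵈ : ∀ d → x <[ d ] y → x ≤[ d ] y
<ᵈ⇒≤ᵈ up   = proj₁
<ᵈ⇒≤ᵈ down = proj₁

<ᵈ⇒≢ : ∀ d → x <[ d ] y → x ≢ y
<ᵈ⇒≢ up   x⊂y = ⊂⇒≢ x⊂y
<ᵈ⇒≢ down y⊂x = ⊂⇒≢ y⊂x ∘ sym

≤ᵈ∧≢⇒<ᵈ : ∀ d → x ≤[ d ] y → x ≢ y → x <[ d ] y
≤ᵈ∧≢⇒<ᵈ up   x⊆y x≢y = ⊆∧≢⇒⊂ x⊆y x≢y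
≤ᵈ∧≢⇒<ᵈ down y⊆x x≢y = ⊆∧≢⇒⊂ y⊆x (x≢y ∘ sym)

<ᵈ⇒Adj : ∀ d → x <[ d ] y → Adj x y
<ᵈ⇒Adj up   = inj₁
<ᵈ⇒Adj down = inj₂

≤ᵈ⇒Comparable : ∀ d → x ≤[ d ] y → Comparable x y
≤ᵈ⇒Comparable up   = inj₁
≤ᵈ⇒Comparable down = inj₂

Comparable⇒≤ᵈ⊎≥ᵈ : ∀ d → Comparable x y → x ≤[ d ] y ⊎ y ≤[ d ] x
Comparable⇒≤ᵈ⊎≥ᵈ up   = id
Comparable⇒≤ᵈ⊎≥ᵈ down = Sum.swap

Adj⇒<ᵈ⊎>ᵈ : ∀ d → Adj x y → x <[ d ] y ⊎ y <[ d ] x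
Adj⇒<ᵈ⊎>ᵈ up   = id
Adj⇒<ᵈ⊎>ᵈ down = Sum.swap

<ᵈ? : ∀ d (x y : Subset n) → Dec (x <[ d ] y)
<ᵈ? up   x y = x ⊂? y
<ᵈ? down x y = y ⊂? x

<-opposite : ∀ d → x <[ opposite d ] y → y <[ d ] x
<-opposite up   = id
<-opposite down = id

⋁[_] : Dir → List (Subset n) → Subset n
⋁[ up ]   = ⋃
⋁[ down ] = ⋂

≤ᵈ-⋁ : ∀ d {xs} → x ∈ₗ xs → x ≤[ d ] ⋁[ d ] xs
≤ᵈ-⋁ up   {x ∷ xs} (here refl) = p⊆p∪q (⋃ xs)
≤ᵈ-⋁ up   {y ∷ xs} (there x∈xs) = q⊆p∪q y (⋃ xs) ∘ ≤ᵈ-⋁ up x∈xs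
≤ᵈ-⋁ down {x ∷ xs} (here refl) = p∩q⊆p x (⋂ xs)
≤ᵈ-⋁ down {y ∷ xs} (there x∈xs) = ≤ᵈ-⋁ down x∈xs ∘ p∩q⊆q y (⋂ xs)

⋁-least : ∀ d {xs} → (∀ {x} → x ∈ₗ xs → x ≤[ d ] y) → ⋁[ d ] xs ≤[ d ] y
⋁-least up   {[]}     _ = ⊥⊆
⋁-least up   {x ∷ xs} bound = Sum.[ bound (here refl) , ⋁-least up (bound ∘ there) ]′ ∘ x∈p∪q⁻ x (⋃ xs)
⋁-least down {[]}     _ = ⊆⊤
⋁-least down {x ∷ xs} bound = λ e∈y → x∈p∩q⁺ (bound (here refl) e∈y , ⋁-least down (bound ∘ there) e∈y)

module Coordinate {n : ℕ} (i : Fin n) where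

  Gains : Dir → Subset n → Set
  Gains up   x = i ∈ x
  Gains down x = i ∉ x

  Gains? : ∀ d x → Dec (Gains d x)
  Gains? up   x = i ∈? x
  Gains? down x = ¬? (i ∈? x)

  Gains⊎Lacks : ∀ d x → Gains d x ⊎ Gains (opposite d) x
  Gains⊎Lacks up   x = Sum.swap (Gains⊎Lacks down x)
  Gains⊎Lacks down x with i ∈? x
  ... | yes i∈x = inj₂ i∈x
  ... | no i∉x  = inj₁ i∉x

  Gains⇒¬Lacks : ∀ d {x} → Gains d x → ¬ Gains (opposite d) x
  Gains⇒¬Lacks up   i∈x i∉x = i∉x i∈x
  Gains⇒¬Lacks down i∉x i∈x = i∉x i∈x

  Gains-opposite² : ∀ d {x} → Gains d x → Gains (opposite (opposite d)) x
  Gains-opposite² up   = id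
  Gains-opposite² down = id

  Gains-mono : ∀ d {x y} → x ≤[ d ] y → Gains d x → Gains d y
  Gains-mono up   x⊆y i∈x = x⊆y i∈x
  Gains-mono down y⊆x i∉x = i∉x ∘ y⊆x

  toggle : Dir → Subset n → Subset n
  toggle up   x = x ∪ ⁅ i ⁆
  toggle down x = x ∩ ∁ ⁅ i ⁆

  private
    ∈toggle-down⁺ : ∀ {x e} → e ∈ x → e ≢ i → e ∈ toggle down x
    ∈toggle-down⁺ e∈x e≢i = x∈p∩q⁺ (e∈x , x∉p⇒x∈∁p (x≢y⇒x∉⁅y⁆ e≢i))

    ∈toggle-down⁻ : ∀ {x e} → e ∈ toggle down x → e ∈ x × e ≢ i
    ∈toggle-down⁻ {x} e∈ with x∈p∩q⁻ x (∁ ⁅ i ⁆) e∈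
    ... | e∈x , e∈∁i = e∈x , λ { refl → x∈∁p⇒x∉p e∈∁i (x∈⁅x⁆ i) }

    ∈toggle-up⁻ : ∀ {x e} → e ∈ toggle up x → e ∈ x ⊎ e ≡ i
    ∈toggle-up⁻ {x} e∈ = Sum.map₂ (x∈⁅y⁆⇒x≡y i) (x∈p∪q⁻ x ⁅ i ⁆ e∈)

  ≤-toggle : ∀ d x → x ≤[ d ] toggle d x
  ≤-toggle up   x = p⊆p∪q ⁅ i ⁆
  ≤-toggle down x = proj₁ ∘ ∈toggle-down⁻

  Gains-toggle : ∀ d x → Gains d (toggle d x)
  Gains-toggle up   x = q⊆p∪q x ⁅ i ⁆ (x∈⁅x⁆ i)
  Gains-toggle down x i∈ = proj₂ (∈toggle-down⁻ i∈) refl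

  toggle-least : ∀ d {x y} → x ≤[ d ] y → Gains d y → toggle d x ≤[ d ] y
  toggle-least up   x⊆y i∈y e∈ = Sum.[ x⊆y , (λ { refl → i∈y }) ]′ (∈toggle-up⁻ e∈)
  toggle-least down y⊆x i∉y e∈y = ∈toggle-down⁺ (y⊆x e∈y) λ { refl → i∉y e∈y }

  ≤-toggle⇒≤ : ∀ d {x y} → Gains (opposite d) x → x ≤[ d ] toggle d y → x ≤[ d ] y
  ≤-toggle⇒≤ up   i∉x x⊆ e∈x = Sum.[ id , (λ { refl → ⊥-elim (i∉x e∈x) }) ]′ (∈toggle-up⁻ (x⊆ e∈x))
  ≤-toggle⇒≤ down i∈x ⊆x {e} e∈y with e ≟ᶠ i
  ... | yes refl = i∈x
  ... | no e≢i   = ⊆x (∈toggle-down⁺ e∈y e≢i)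

  toggle-down-up : ∀ {x} → i ∈ x → toggle up (toggle down x) ≡ x
  toggle-down-up {x} i∈x = ⊆-antisym (toggle-least up (≤-toggle down x) i∈x) x⊆
    where
    x⊆ : x ⊆ toggle up (toggle down x)
    x⊆ {e} e∈x with e ≟ᶠ i
    ... | yes refl = Gains-toggle up _
    ... | no e≢i   = ≤-toggle up _ (∈toggle-down⁺ e∈x e≢i)

-- Every coordinate is an edge of an N-saturated family

module Saturated {n : ℕ} (F : Family n) (saturated : NSaturated F) where

  open Regions _≟ˢ_ (members F)
  open P4FreeGraphs _≟ˢ_ (members F)

  free : P4Free (_∈F F)
  free = N-free⇒P4Free (proj₁ saturated)

  ¬P4Free-∪ : ∀ {X} → X ∉F F → ¬ P4Free (F ∪₁ X)
  ¬P4Free-∪ X∉F free′ = P4Free⇒N-free free′ (proj₂ saturated _ X∉F)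

  comparabilityGraph : P4FreeGraph
  comparabilityGraph = record
    { _~_ = Adj ; _≁_ = Incomparable ; _~?_ = Adj? ; _≁?_ = Incomparable?
    ; ~-sym = Adj-sym ; ≁-sym = Incomparable-sym ; ~⇒¬≁ = Adj⇒¬Incomparable ; ~⊎≁ = Adj⊎Incomparable
    ; p4-free = λ ma mb mc md ab bc cd ac bd ad → free ma mb mc md (ab , bc , cd , ac , bd , ad) }

  ∈F-if-comparable-to-all : ∀ {X} → (∀ {v} → v ∈F F → Comparable X v) → X ∈F F
  ∈F-if-comparable-to-all {X} X∼ with ∈F? F X
  ... | yes X∈F = X∈F
  ... | no X∉F = ⊥-elim (¬P4Free-∪ X∉F (P4Free-∪-comparable X∼ free))

  SeenAlike : Region → Subset n → Set
  SeenAlike M X = ∀ {E m} → E ∈F F → ¬ Holds M E → m ∈ᴿ M → (Adj E m → Adj E X) × (Adj E X → Adj E m)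

  ¬substitutable : ∀ {M m₀ X} → m₀ ∈ᴿ M → X ∉F F → SeenAlike M X → ¬ P4Free (λ v → v ∈ᴿ M ⊎ v ≡ X)
  ¬substitutable {M} {m₀} {X} m₀∈M X∉F alike locally-free =
    ¬P4Free-∪ X∉F (P4Free-substitution M∪X-module (inj₁ m₀∈M) M∪X? (P4Free-mono proj₂ locally-free)
                                       (P4Free-mono collapsed free))
    where
    M∪X : Subset n → Set
    M∪X v = v ∈ᴿ M ⊎ v ≡ X
    M∪X? : ∀ v → Dec (M∪X v)
    M∪X? v = (v ∈ᴿ? M) ⊎-dec (v ≟ˢ X)
    M∪X-module : IsModule (F ∪₁ X) M∪X
    M∪X-module (inj₂ w≡X) w∉ = ⊥-elim (w∉ (inj₂ w≡X))
    M∪X-module {w} {p} {q} (inj₁ w∈F) w∉ p∈ q∈ = from-X q∈ ∘ to-X p∈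
      where
      w∉M : ¬ Holds M w
      w∉M w∈M = w∉ (inj₁ (w∈F , w∈M))
      to-X : ∀ {v} → M∪X v → Adj w v → Adj w X
      to-X (inj₁ v∈M) = proj₁ (alike w∈F w∉M v∈M)
      to-X (inj₂ refl) = id
      from-X : ∀ {v} → M∪X v → Adj w X → Adj w v
      from-X (inj₁ v∈M) = proj₂ (alike w∈F w∉M v∈M)
      from-X (inj₂ refl) = id
    collapsed : ∀ {v} → ((v ∈F F ⊎ v ≡ X) × ¬ M∪X v) ⊎ v ≡ m₀ → v ∈F F
    collapsed (inj₁ (inj₁ v∈F , _)) = v∈F
    collapsed (inj₁ (inj₂ v≡X , v∉)) = ⊥-elim (v∉ (inj₂ v≡X))
    collapsed (inj₂ refl) = ∈G m₀∈M

  Below : Dir → Subset n → Region → Set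
  Below d E K = ∀ {x} → x ∈ᴿ K → E <[ d ] x

  Apart : Subset n → Region → Set
  Apart E K = ∀ {x} → x ∈ᴿ K → Incomparable E x

  Uniform : Subset n → Region → Set
  Uniform E K = Below up E K ⊎ Below down E K ⊎ Apart E K

  Uniform-⊆ : ∀ {E K L} → (∀ {x} → x ∈ᴿ L → x ∈ᴿ K) → Uniform E K → Uniform E L
  Uniform-⊆ L⊆K = Sum.map (_∘ L⊆K) (Sum.map (_∘ L⊆K) (_∘ L⊆K))

  Autonomous : Region → Set
  Autonomous K = ∀ {E} → E ∈F F → ¬ Holds K E → Uniform E K

  autonomous[_] : ∀ d {K E} → Autonomous K → E ∈F F → ¬ Holds K E →
                  Below d E K ⊎ Below (opposite d) E K ⊎ Apart E K
  autonomous[ up ] autK E∈F E∉K = autK E∈F E∉K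
  autonomous[ down ] autK E∈F E∉K with autK E∈F E∉K
  ... | inj₁ below       = inj₂ (inj₁ below)
  ... | inj₂ (inj₁ above) = inj₁ above
  ... | inj₂ (inj₂ apart) = inj₂ (inj₂ apart)

  Universal : Region → Subset n → Set
  Universal K u = u ∈ᴿ K × (∀ {x} → x ∈ᴿ K → Comparable u x)

  -- Were X outside F, it could be substituted into the autonomous set K, which it extends.
  sandwich : ∀ d {K X p q} → Autonomous K → (∀ {x} → x ∈ᴿ K → Comparable X x) →
             p ∈ᴿ K → p ≤[ d ] X → q ∈ᴿ K → X ≤[ d ] q → X ∈ᴿ K
  sandwich d {K} {X} {p} {q} autK X∼ p∈K p≤X q∈K X≤q with ∈F? F X
  ... | no X∉F = ⊥-elim (¬substitutable p∈K X∉F alike (P4Free-∪-comparable X∼ (P4Free-mono ∈G free)))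
    where
    alike : SeenAlike K X
    alike {E} E∈F E∉K m∈K with autonomous[ d ] autK E∈F E∉K
    ... | inj₁ E<K = (λ _ → <ᵈ⇒Adj d (<ᵈ-≤ᵈ-trans d (E<K p∈K) p≤X)) , (λ _ → <ᵈ⇒Adj d (E<K m∈K))
    ... | inj₂ (inj₁ K<E) = (λ _ → Adj-sym (<ᵈ⇒Adj d (≤ᵈ-<ᵈ-trans d X≤q (<-opposite d (K<E q∈K))))) ,
                            (λ _ → Adj-sym (<ᵈ⇒Adj d (<-opposite d (K<E m∈K))))
    ... | inj₂ (inj₂ E∥K) = (λ E~m → ⊥-elim (Adj⇒¬Incomparable E~m (E∥K m∈K))) ,
                            (λ E~X → ⊥-elim (E≁X (Adj⇒Comparable E~X)))
      where
      E≁X : ¬ Comparable E X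
      E≁X E∼X with Comparable⇒≤ᵈ⊎≥ᵈ d E∼X
      ... | inj₁ E≤X = Comparable⇒¬Incomparable (≤ᵈ⇒Comparable d (≤ᵈ-trans d E≤X X≤q)) (E∥K q∈K)
      ... | inj₂ X≤E = Comparable⇒¬Incomparable (Comparable-sym (≤ᵈ⇒Comparable d (≤ᵈ-trans d p≤X X≤E)))
                                                 (E∥K p∈K)
  ... | yes X∈F with holds? K X
  ...   | yes X∈K = X∈F , X∈K
  ...   | no X∉K with autonomous[ d ] autK X∈F X∉K
  ...     | inj₁ X<K = ⊥-elim (<ᵈ⇒≢ d (<ᵈ-≤ᵈ-trans d (X<K p∈K) p≤X) refl)
  ...     | inj₂ (inj₁ K<X) = ⊥-elim (<ᵈ⇒≢ d (<ᵈ-≤ᵈ-trans d (<-opposite d (K<X q∈K)) X≤q) refl)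
  ...     | inj₂ (inj₂ X∥K) = ⊥-elim (Comparable⇒¬Incomparable (Comparable-sym (≤ᵈ⇒Comparable d p≤X)) (X∥K p∈K))

  private
    members-in : Region → List (Subset n)
    members-in K = filter (holds? K) (members F)

  module _ {K S A : Region} (autK : Autonomous K) (across : Across Adj K S) {a₂ b₂ : Subset n}
           (a₂∈ : a₂ ∈ᴿ (K ∩ᴿ S) ∩ᴿ A) (b₂∈ : b₂ ∈ᴿ (K ∩ᴿ S) ∖ᴿ A)
           (apart : Across Incomparable (K ∩ᴿ S) A) where

    private
      a₂∈KS : a₂ ∈ᴿ K ∩ᴿ S
      a₂∈KS = ∩-left a₂∈

      b₂∈KS : b₂ ∈ᴿ K ∩ᴿ S
      b₂∈KS = ∩-left b₂∈

      -- a₂ and b₂ are incomparable, so nothing outside S lies between elements of K ∩ S.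
      above-a₂⇒above-all : ∀ d {t s} → t ∈ᴿ K ∖ᴿ S → a₂ <[ d ] t → s ∈ᴿ K ∩ᴿ S → s <[ d ] t
      above-a₂⇒above-all d t∈ a₂<t s∈KS with Adj⇒<ᵈ⊎>ᵈ d (across s∈KS t∈)
      ... | inj₁ s<t = s<t
      ... | inj₂ t<s with holds? A _
      ...   | no s∉A = ⊥-elim (Adj⇒¬Incomparable (<ᵈ⇒Adj d (<ᵈ-trans d a₂<t t<s)) (apart a₂∈ (∈∩ s∈KS s∉A)))
      ...   | yes s∈A with Adj⇒<ᵈ⊎>ᵈ d (across b₂∈KS t∈)
      ...     | inj₁ b₂<t = ⊥-elim (Adj⇒¬Incomparable (Adj-sym (<ᵈ⇒Adj d (<ᵈ-trans d b₂<t t<s)))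
                                                       (apart (∈∩ s∈KS s∈A) b₂∈))
      ...     | inj₂ t<b₂ = ⊥-elim (Adj⇒¬Incomparable (<ᵈ⇒Adj d (<ᵈ-trans d a₂<t t<b₂)) (apart a₂∈ b₂∈))

      -- The join of K ∩ S towards b is comparable to all of K and lies between a and b.
      universal-towards : ∀ d {a b} → a ∈ᴿ K ∩ᴿ S → b ∈ᴿ K ∖ᴿ S → a₂ <[ d ] b → ∃ (Universal K)
      universal-towards d {b = b} a∈KS b∈ a₂<b =
        U , sandwich d autK U∼ (∩-left a∈KS) (≤U a∈KS) (∩-left b∈) U≤b , U∼
        where
        U : Subset n
        U = ⋁[ d ] (members-in (K ∩ᴿ S))
        ≤U : ∀ {s} → s ∈ᴿ K ∩ᴿ S → s ≤[ d ] U
        ≤U s∈KS = ≤ᵈ-⋁ d (∈-filter⁺ (holds? (K ∩ᴿ S)) (∈G s∈KS) (holds s∈KS))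
        U≤ : ∀ {t} → t ∈ᴿ K ∖ᴿ S → a₂ <[ d ] t → U ≤[ d ] t
        U≤ t∈ a₂<t = ⋁-least d λ s∈ → let (s∈G , KSs) = ∈-filter⁻ (holds? (K ∩ᴿ S)) {xs = members F} s∈ in
                                     <ᵈ⇒≤ᵈ d (above-a₂⇒above-all d t∈ a₂<t (s∈G , KSs))
        U≤b : U ≤[ d ] b
        U≤b = U≤ b∈ a₂<b
        U∼ : ∀ {x} → x ∈ᴿ K → Comparable U x
        U∼ x∈K with holds? S _
        ... | yes x∈S = Comparable-sym (≤ᵈ⇒Comparable d (≤U (∈∩ x∈K x∈S)))
        ... | no x∉S with Adj⇒<ᵈ⊎>ᵈ d (across a₂∈KS (∈∩ x∈K x∉S))
        ...   | inj₁ a₂<x = ≤ᵈ⇒Comparable d (U≤ (∈∩ x∈K x∉S) a₂<x)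
        ...   | inj₂ x<a₂ = Comparable-sym (≤ᵈ⇒Comparable d (≤ᵈ-trans d (<ᵈ⇒≤ᵈ d x<a₂) (≤U a₂∈KS)))

    universal-beside : ∀ {a b} → a ∈ᴿ K ∩ᴿ S → b ∈ᴿ K ∖ᴿ S → ∃ (Universal K)
    universal-beside a∈KS b∈ with across a₂∈KS b∈
    ... | inj₁ a₂⊂b = universal-towards up a∈KS b∈ a₂⊂b
    ... | inj₂ b⊂a₂ = universal-towards down a∈KS b∈ b⊂a₂

  -- Refine the side S of the cosplit until K ∩ S is a single element or has disconnected comparability graph.
  cosplit⇒universal : ∀ {K} → Autonomous K → Split Adj K → ∃ (Universal K)
  cosplit⇒universal {K} autK sp = go sp (⊰-wellFounded _)
    where
    go : (sp : Split Adj K) → Acc _⊰_ (K ∩ᴿ Split.side sp) → ∃ (Universal K)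
    go (split S {a} a∈KS (b∈G , (Kb , b∉S)) across) (acc rs) with anyᴿ? (K ∩ᴿ S) (λ s → ¬? (s ≟ˢ a))
    ... | no only-a = a , ∩-left a∈KS , a∼
      where
      a∼ : ∀ {x} → x ∈ᴿ K → Comparable a x
      a∼ {x} x∈K with x ≟ˢ a | holds? S x
      ... | yes refl | _       = inj₁ ⊆-refl
      ... | no x≢a   | yes x∈S = ⊥-elim (only-a (x , ∈∩ x∈K x∈S , x≢a))
      ... | no _     | no x∉S  = Adj⇒Comparable (across a∈KS (∈∩ x∈K x∉S))
    ... | yes (s , s∈KS , s≢a) with seinsche comparabilityGraph a∈KS s∈KS (s≢a ∘ sym)
    ...   | inj₁ (split A a₂∈ b₂∈ apart) = universal-beside autK across a₂∈ b₂∈ apart a∈KS (b∈G , (Kb , b∉S))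
    ...   | inj₂ (split S₁ (a₁∈G , ((Ka₁ , Sa₁) , a₁∈S₁)) b₁∈@(_ , (_ , b₁∉S₁)) across₁) =
              go (split (S ∩ᴿ S₁) (a₁∈G , (Ka₁ , (Sa₁ , a₁∈S₁))) (b∈G , (Kb , b∉S ∘ proj₁)) across′) (rs S∩S₁⊰S)
      where
      across′ : Across Adj K (S ∩ᴿ S₁)
      across′ (x∈G , (Kx , (Sx , S₁x))) (y∈G , (Ky , y∉SS₁)) with holds? S _
      ... | no y∉S = across (x∈G , (Kx , Sx)) (y∈G , (Ky , y∉S))
      ... | yes Sy = across₁ (x∈G , ((Kx , Sx) , S₁x)) (y∈G , ((Ky , Sy) , y∉SS₁ ∘ (Sy ,_)))
      S∩S₁⊰S : K ∩ᴿ (S ∩ᴿ S₁) ⊰ K ∩ᴿ S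
      S∩S₁⊰S = shrink (λ (_ , (Ky , (Sy , _))) → Ky , Sy) (∩-left b₁∈) (b₁∉S₁ ∘ proj₂ ∘ proj₂)

  autonomous-∩ : ∀ {K S} → Autonomous K → Across Incomparable K S → Autonomous (K ∩ᴿ S)
  autonomous-∩ {K} {S} autK apart {E} E∈F E∉KS with holds? K E
  ... | yes E∈K = inj₂ (inj₂ λ x∈KS → Incomparable-sym (apart x∈KS (E∈F , (E∈K , E∉KS ∘ (E∈K ,_)))))
  ... | no E∉K = Uniform-⊆ ∩-left (autK E∈F E∉K)

  above : Dir → Subset n → Region
  above d u = region (u <[ d ]_) (<ᵈ? d u)

  record Hub (K : Region) (z y : Subset n) : Set₁ where
    constructor hub
    field
      {part}     : Region
      {centre}   : Subset n
      autonomous : Autonomous part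
      part⊆K     : ∀ {x} → x ∈ᴿ part → Holds K x
      z∈part     : z ∈ᴿ part
      y∈part     : y ∈ᴿ part
      universal  : Universal part centre

  hub-⊆ : ∀ {K L z y} → (∀ {x} → x ∈ᴿ L → Holds K x) → Hub L z y → Hub K z y
  hub-⊆ L⊆K (hub autP P⊆L z∈P y∈P univ) = hub autP (λ x∈P → L⊆K (∈G x∈P , P⊆L x∈P)) z∈P y∈P univ

  -- Descend into the side containing z and y of incomparable splits until a cosplit appears.
  find-hub : ∀ {K z y} → Autonomous K → z ∈ᴿ K → y ∈ᴿ K → Adj z y → Hub K z y
  find-hub {K} {z} {y} autK z∈K y∈K z~y = go (⊰-wellFounded K) autK z∈K y∈K
    where
    go : ∀ {K} → Acc _⊰_ K → Autonomous K → z ∈ᴿ K → y ∈ᴿ K → Hub K z y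
    go (acc rs) autK z∈K y∈K with seinsche comparabilityGraph z∈K y∈K (Adj⇒≢ z~y)
    ... | inj₂ cosplit = hub autK holds z∈K y∈K (proj₂ (cosplit⇒universal autK cosplit))
    ... | inj₁ (split S a∈ b∈ apart) with holds? S z
    ...   | yes z∈S =
            hub-⊆ (proj₁ ∘ holds) (go (rs (∩⊰ b∈)) (autonomous-∩ autK apart) (∈∩ z∈K z∈S) (∈∩ y∈K y∈S))
      where
      y∈S : Holds S y
      y∈S = decidable-stable (holds? S y) (Adj⇒¬Incomparable z~y ∘ apart (∈∩ z∈K z∈S) ∘ ∈∩ y∈K)
    ...   | no z∉S =
            hub-⊆ (proj₁ ∘ holds) (go (rs (∩⊰ (∈∩ (∩-left a∈) (_$ proj₂ (holds a∈)))))
                                      (autonomous-∩ autK (Across-∁ Incomparable-sym apart)) (∈∩ z∈K z∉S) (∈∩ y∈K y∉S))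
      where
      y∉S : ¬ Holds S y
      y∉S y∈S = Adj⇒¬Incomparable (Adj-sym z~y) (apart (∈∩ y∈K y∈S) (∈∩ z∈K z∉S))

  Below⇒Uniform : ∀ d {E K} → Below d E K → Uniform E K
  Below⇒Uniform up   = inj₁
  Below⇒Uniform down = inj₂ ∘ inj₁

  ∅∈F : ∅ ∈F F
  ∅∈F = ∈F-if-comparable-to-all λ _ → inj₁ ⊥⊆

  ⊤∈F : ⊤ ∈F F
  ⊤∈F = ∈F-if-comparable-to-all λ _ → inj₂ ⊆⊤

  hub-⊰ : ∀ d {K z y} (h : Hub K z y) → Hub.part h ∩ᴿ above d (Hub.centre h) ⊰ K
  hub-⊰ d (hub _ P⊆K _ _ (u∈P , _)) = shrink (P⊆K ∘ ∩-left) (∈G u∈P , P⊆K u∈P) λ (_ , u<u) → <ᵈ⇒≢ d u<u refl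

  module AboveCentre (d : Dir) {K u} (autK : Autonomous K) (univ : Universal K u) where

    private
      u∈K : u ∈ᴿ K
      u∈K = proj₁ univ

      u∼ : ∀ {x} → x ∈ᴿ K → Comparable u x
      u∼ = proj₂ univ

      P : Region
      P = K ∩ᴿ above d u

      ≤centre : ∀ {E} → E ∈ᴿ K → ¬ Holds P E → E ≤[ d ] u
      ≤centre {E} E∈K E∉P with Comparable⇒≤ᵈ⊎≥ᵈ d (u∼ E∈K)
      ... | inj₂ E≤u = E≤u
      ... | inj₁ u≤E with u ≟ˢ E
      ...   | yes refl = ≤ᵈ-refl d
      ...   | no u≢E   = ⊥-elim (E∉P (holds E∈K , ≤ᵈ∧≢⇒<ᵈ d u≤E u≢E))

    above-autonomous : Autonomous P
    above-autonomous {E} E∈F E∉P with holds? K E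
    ... | yes E∈K = Below⇒Uniform d λ x∈P → ≤ᵈ-<ᵈ-trans d (≤centre (E∈F , E∈K) E∉P) (proj₂ (holds x∈P))
    ... | no E∉K  = Uniform-⊆ ∩-left (autK E∈F E∉K)

    below⇒≤centre : ∀ {w E} → w ∈ᴿ P → E ∈F F → ¬ Holds P E → Below d E P → E ≤[ d ] u
    below⇒≤centre {w} {E} w∈P E∈F E∉P E<P with holds? K E
    ... | yes E∈K = ≤centre (E∈F , E∈K) E∉P
    ... | no E∉K with autonomous[ d ] autK E∈F E∉K
    ...   | inj₁ E<K        = <ᵈ⇒≤ᵈ d (E<K u∈K)
    ...   | inj₂ (inj₁ K<E) = ⊥-elim (<ᵈ⇒≢ d (<ᵈ-trans d (E<P w∈P) (<-opposite d (K<E (∩-left w∈P)))) refl)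
    ...   | inj₂ (inj₂ E∥K) = ⊥-elim (Adj⇒¬Incomparable (<ᵈ⇒Adj d (E<P w∈P)) (E∥K (∩-left w∈P)))

    apart⇒≰centre : ∀ {w E} → w ∈ᴿ P → E ∈F F → ¬ Holds P E → Apart E P → ¬ u ≤[ d ] E
    apart⇒≰centre {w} {E} w∈P E∈F E∉P E∥P u≤E with holds? K E
    ... | yes E∈K with ≤ᵈ-antisym d (≤centre (E∈F , E∈K) E∉P) u≤E
    ...   | refl = Adj⇒¬Incomparable (<ᵈ⇒Adj d (proj₂ (holds w∈P))) (E∥P w∈P)
    apart⇒≰centre {w} {E} w∈P E∈F E∉P E∥P u≤E | no E∉K with autonomous[ d ] autK E∈F E∉K
    ...   | inj₁ E<K        = Adj⇒¬Incomparable (<ᵈ⇒Adj d (E<K (∩-left w∈P))) (E∥P w∈P)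
    ...   | inj₂ (inj₁ K<E) = Adj⇒¬Incomparable (Adj-sym (<ᵈ⇒Adj d (<-opposite d (K<E (∩-left w∈P))))) (E∥P w∈P)
    ...   | inj₂ (inj₂ E∥K) = Comparable⇒¬Incomparable (Comparable-sym (≤ᵈ⇒Comparable d u≤E)) (E∥K u∈K)

  module Descent (i : Fin n) (no-edge : ∀ {A} → A ∈F F → i ∉ A → (A ∪ ⁅ i ⁆) ∉F F) where
    open Coordinate i

    no-toggle : ∀ d {Λ} → Λ ∈F F → Gains (opposite d) Λ → toggle d Λ ∉F F
    no-toggle up   Λ∈F i∉Λ = no-edge Λ∈F i∉Λ
    no-toggle down Λ∈F i∈Λ Λ′∈F = no-edge Λ′∈F (Gains-toggle down _) (subst (_∈F F) (sym (toggle-down-up i∈Λ)) Λ∈F)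

    -- The last two fields let Λ stand in for P ∪ {Λ} towards the members of F outside P.
    record State (d : Dir) (P : Region) : Set₁ where
      field
        {Λ w}     : Subset n
        Λ∈F       : Λ ∈F F
        Λ-lacks   : Gains (opposite d) Λ
        P-autonomous : Autonomous P
        Λ<P       : Below d Λ P
        w∈P       : w ∈ᴿ P
        w-gains   : Gains d w
        below⇒≤Λ  : ∀ {E} → E ∈F F → ¬ Holds P E → Below d E P → E ≤[ d ] Λ
        apart⇒≰Λ  : ∀ {E} → E ∈F F → ¬ Holds P E → Apart E P → ¬ Λ ≤[ d ] E

    state-at : ∀ d {K u w} → Autonomous K → Universal K u → Gains (opposite d) u → w ∈ᴿ K → Gains d w →
               State d (K ∩ᴿ above d u)
    state-at d {K} {u} {w} autK univ@(u∈K , u∼) u-lacks w∈K w-gains = record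
      { Λ∈F = ∈G u∈K ; Λ-lacks = u-lacks ; P-autonomous = above-autonomous ; Λ<P = proj₂ ∘ holds
      ; w∈P = w∈P ; w-gains = w-gains ; below⇒≤Λ = below⇒≤centre w∈P ; apart⇒≰Λ = apart⇒≰centre w∈P }
      where
      open AboveCentre d autK univ
      u<w : u <[ d ] w
      u<w with Comparable⇒≤ᵈ⊎≥ᵈ d (u∼ w∈K)
      ... | inj₁ u≤w = ≤ᵈ∧≢⇒<ᵈ d u≤w λ { refl → Gains⇒¬Lacks d w-gains u-lacks }
      ... | inj₂ w≤u = ⊥-elim (Gains⇒¬Lacks d (Gains-mono d w≤u w-gains) u-lacks)
      w∈P : w ∈ᴿ K ∩ᴿ above d u
      w∈P = ∈∩ w∈K u<w

    Mixed : Dir → Region → Set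
    Mixed d P = ∃ λ z → z ∈ᴿ P × Gains (opposite d) z × ∃ λ y → y ∈ᴿ P × Gains d y × z <[ d ] y

    mixed? : ∀ d P → Dec (Mixed d P)
    mixed? d P = anyᴿ? P λ z → Gains? (opposite d) z ×-dec anyᴿ? P λ y → Gains? d y ×-dec <ᵈ? d z y

    -- Without a mixed pair in P, toggling i in Λ would give a set that can be substituted for Λ.
    module Unmixed {d P} (st : State d P) (unmixed : ¬ Mixed d P) where
      open State st

      private
        X : Subset n
        X = toggle d Λ

        M : Region
        M = P ∪ᴿ ｛ Λ ｝ᴿ

        Λ<w : Λ <[ d ] w
        Λ<w = Λ<P w∈P

        X≤w : X ≤[ d ] w
        X≤w = toggle-least d (<ᵈ⇒≤ᵈ d Λ<w) w-gains

        alike : SeenAlike M X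
        alike {E} {m} E∈F E∉M m∈M with autonomous[ d ] P-autonomous E∈F (E∉M ∘ inj₁)
        ... | inj₁ E<P = (λ _ → <ᵈ⇒Adj d (<ᵈ-≤ᵈ-trans d E<Λ (≤-toggle d Λ))) , (λ _ → E~m m∈M)
          where
          E<Λ : E <[ d ] Λ
          E<Λ = ≤ᵈ∧≢⇒<ᵈ d (below⇒≤Λ E∈F (E∉M ∘ inj₁) E<P) (E∉M ∘ inj₂)
          E~m : m ∈ᴿ M → Adj E m
          E~m (m∈G , inj₁ m∈P) = <ᵈ⇒Adj d (E<P (m∈G , m∈P))
          E~m (_ , inj₂ refl)  = <ᵈ⇒Adj d E<Λ
        ... | inj₂ (inj₁ P<E) = (λ _ → Adj-sym (<ᵈ⇒Adj d (≤ᵈ-<ᵈ-trans d X≤w w<E))) , (λ _ → Adj-sym (m~E m∈M))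
          where
          w<E : w <[ d ] E
          w<E = <-opposite d (P<E w∈P)
          m~E : m ∈ᴿ M → Adj m E
          m~E (m∈G , inj₁ m∈P) = <ᵈ⇒Adj d (<-opposite d (P<E (m∈G , m∈P)))
          m~E (_ , inj₂ refl)  = <ᵈ⇒Adj d (<ᵈ-trans d Λ<w w<E)
        ... | inj₂ (inj₂ E∥P) = (λ E~m → ⊥-elim (¬E~m m∈M E~m)) , (λ E~X → ⊥-elim (¬E~X E~X))
          where
          ¬E~m : m ∈ᴿ M → ¬ Adj E m
          ¬E~m (m∈G , inj₁ m∈P) E~m = Adj⇒¬Incomparable E~m (E∥P (m∈G , m∈P))
          ¬E~m (_ , inj₂ refl) E~Λ with Adj⇒<ᵈ⊎>ᵈ d E~Λ
          ... | inj₁ E<Λ = Adj⇒¬Incomparable (<ᵈ⇒Adj d (<ᵈ-trans d E<Λ Λ<w)) (E∥P w∈P)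
          ... | inj₂ Λ<E = apart⇒≰Λ E∈F (E∉M ∘ inj₁) E∥P (<ᵈ⇒≤ᵈ d Λ<E)
          ¬E~X : ¬ Adj E X
          ¬E~X E~X with Adj⇒<ᵈ⊎>ᵈ d E~X
          ... | inj₁ E<X = Adj⇒¬Incomparable (<ᵈ⇒Adj d (<ᵈ-≤ᵈ-trans d E<X X≤w)) (E∥P w∈P)
          ... | inj₂ X<E = apart⇒≰Λ E∈F (E∉M ∘ inj₁) E∥P (≤ᵈ-trans d (≤-toggle d Λ) (<ᵈ⇒≤ᵈ d X<E))

        -- On a path X – u – v with v not adjacent to X, u gains i, v lacks it, and v lies below u.
        no-path : ∀ {u v} → u ∈ᴿ P ⊎ u ≡ X → v ∈ᴿ P ⊎ v ≡ X → Adj X u → Adj u v → Incomparable X v → ⊥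
        no-path (inj₂ refl) _ X~X _ _ = Adj⇒≢ X~X refl
        no-path _ (inj₂ refl) _ _ X∥X = Incomparable⇒≢ X∥X refl
        no-path {u} {v} (inj₁ u∈P) (inj₁ v∈P) X~u u~v X∥v = unmixed (v , v∈P , v-lacks , u , u∈P , u-gains , v<u)
          where
          u-gains : Gains d u
          u-gains with Gains⊎Lacks d u
          ... | inj₁ u-gains = u-gains
          ... | inj₂ u-lacks with Adj⇒<ᵈ⊎>ᵈ d X~u
          ...   | inj₁ X<u = ⊥-elim (Gains⇒¬Lacks d (Gains-mono d (<ᵈ⇒≤ᵈ d X<u) (Gains-toggle d Λ)) u-lacks)
          ...   | inj₂ u<X = ⊥-elim (<ᵈ⇒≢ d (<ᵈ-≤ᵈ-trans d (Λ<P u∈P) (≤-toggle⇒≤ d u-lacks (<ᵈ⇒≤ᵈ d u<X))) refl)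
          v-lacks : Gains (opposite d) v
          v-lacks with Gains⊎Lacks d v
          ... | inj₂ v-lacks = v-lacks
          ... | inj₁ v-gains =
            ⊥-elim (Comparable⇒¬Incomparable (≤ᵈ⇒Comparable d (toggle-least d (<ᵈ⇒≤ᵈ d (Λ<P v∈P)) v-gains)) X∥v)
          v<u : v <[ d ] u
          v<u with Adj⇒<ᵈ⊎>ᵈ d u~v
          ... | inj₂ v<u = v<u
          ... | inj₁ u<v = ⊥-elim (Gains⇒¬Lacks d (Gains-mono d (<ᵈ⇒≤ᵈ d u<v) u-gains) v-lacks)

        P∪X-free : P4Free (λ v → v ∈ᴿ P ⊎ v ≡ X)
        P∪X-free ma mb mc md p4@(ab , bc , cd , ac , bd , _) with ma | mb | mc | md
        ... | inj₂ refl | _ | _ | _ = no-path mb mc ab bc ac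
        ... | _ | inj₂ refl | _ | _ = no-path mc md bc cd bd
        ... | _ | _ | inj₂ refl | _ = no-path mb ma (Adj-sym bc) (Adj-sym ab) (Incomparable-sym ac)
        ... | _ | _ | _ | inj₂ refl = no-path mc mb (Adj-sym cd) (Adj-sym bc) (Incomparable-sym bd)
        ... | inj₁ a∈P | inj₁ b∈P | inj₁ c∈P | inj₁ d∈P = free (∈G a∈P) (∈G b∈P) (∈G c∈P) (∈G d∈P) p4

        locally-free : P4Free (λ v → v ∈ᴿ M ⊎ v ≡ X)
        locally-free = P4Free-mono regroup (P4Free-∪-comparable Λ∼ P∪X-free)
          where
          Λ∼ : ∀ {v} → v ∈ᴿ P ⊎ v ≡ X → Comparable Λ v
          Λ∼ (inj₁ v∈P)  = ≤ᵈ⇒Comparable d (<ᵈ⇒≤ᵈ d (Λ<P v∈P))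
          Λ∼ (inj₂ refl) = ≤ᵈ⇒Comparable d (≤-toggle d Λ)
          regroup : ∀ {v} → v ∈ᴿ M ⊎ v ≡ X → (v ∈ᴿ P ⊎ v ≡ X) ⊎ v ≡ Λ
          regroup (inj₁ (v∈G , inj₁ v∈P)) = inj₁ (inj₁ (v∈G , v∈P))
          regroup (inj₁ (_ , inj₂ v≡Λ))   = inj₂ v≡Λ
          regroup (inj₂ v≡X)              = inj₁ (inj₂ v≡X)

      unmixed⇒⊥ : ⊥
      unmixed⇒⊥ with ∈F? F X
      ... | yes X∈F = no-toggle d Λ∈F Λ-lacks X∈F
      ... | no X∉F  = ¬substitutable (Λ∈F , inj₂ refl) X∉F alike locally-free

    descend : ∀ d {P} → Acc _⊰_ P → State d P → ⊥
    descend d {P} (acc rs) st with mixed? d P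
    ... | no unmixed = Unmixed.unmixed⇒⊥ st unmixed
    ... | yes (z , z∈P , z-lacks , y , y∈P , y-gains , z<y)
          with find-hub (State.P-autonomous st) z∈P y∈P (<ᵈ⇒Adj d z<y)
    ...   | h@(hub autK _ z∈K y∈K univ) with Gains⊎Lacks d (Hub.centre h)
    ...     | inj₂ u-lacks = descend d (rs (hub-⊰ d h)) (state-at d autK univ u-lacks y∈K y-gains)
    ...     | inj₁ u-gains = descend (opposite d) (rs (hub-⊰ (opposite d) h))
                                     (state-at (opposite d) autK univ (Gains-opposite² d u-gains) z∈K z-lacks)

    initial : State up (∁ᴿ ｛ ∅ ｝ᴿ)
    initial = record
      { Λ∈F = ∅∈F ; Λ-lacks = ∉⊥ ; P-autonomous = λ E∈F E∉P → inj₁ (subst (_⊂ _) (sym (is-∅ E∉P)) ∘ ∅<P)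
      ; Λ<P = ∅<P ; w∈P = ⊤∈P ; w-gains = ∈⊤
      ; below⇒≤Λ = λ _ E∉P _ → ⊆-reflexive (is-∅ E∉P) ; apart⇒≰Λ = λ _ _ E∥P _ → proj₁ (E∥P ⊤∈P) ⊆⊤ }
      where
      is-∅ : ∀ {E} → ¬ Holds (∁ᴿ ｛ ∅ ｝ᴿ) E → E ≡ ∅
      is-∅ = decidable-stable (_ ≟ˢ ∅)
      ∅<P : Below up ∅ (∁ᴿ ｛ ∅ ｝ᴿ)
      ∅<P x∈P = ⊆∧≢⇒⊂ ⊥⊆ (holds x∈P ∘ sym)
      ⊤∈P : ⊤ ∈ᴿ ∁ᴿ ｛ ∅ ｝ᴿ
      ⊤∈P = ⊤∈F , λ ⊤≡∅ → ∉⊥ (subst (i ∈_) ⊤≡∅ ∈⊤)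

    no-edge⇒⊥ : ⊥
    no-edge⇒⊥ = descend up (⊰-wellFounded _) initial

  coordinate-edge : ∀ i → ∃ λ A → A ∈F F × i ∉ A × (A ∪ ⁅ i ⁆) ∈F F
  coordinate-edge i with Any.any? (λ A → ¬? (i ∈? A) ×-dec ∈F? F (A ∪ ⁅ i ⁆)) (members F)
  ... | yes edge = let (A , A∈F , i∉A , A+i∈F) = Membership.find edge in A , A∈F , i∉A , A+i∈F
  ... | no none  = ⊥-elim (Descent.no-edge⇒⊥ i λ A∈F i∉A A+i∈F → none (Membership.lose A∈F (i∉A , A+i∈F)))

module _ {n : ℕ} where

  private
    ∈∪⁅⁆⁻ : ∀ {A : Subset n} {j e} → e ∈ A ∪ ⁅ j ⁆ → e ∈ A ⊎ e ≡ j
    ∈∪⁅⁆⁻ {A} {j} = Sum.map₂ (x∈⁅y⁆⇒x≡y j) ∘ x∈p∪q⁻ A ⁅ j ⁆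

    ∈∪⁅⁆ : ∀ {A : Subset n} {j} → j ∈ A ∪ ⁅ j ⁆
    ∈∪⁅⁆ {A} {j} = q⊆p∪q A ⁅ j ⁆ (x∈⁅x⁆ j)

    ∉∪⁅⁆ : ∀ {A : Subset n} {j e} → e ∉ A → e ≢ j → e ∉ A ∪ ⁅ j ⁆
    ∉∪⁅⁆ e∉A e≢j = Sum.[ e∉A , e≢j ]′ ∘ ∈∪⁅⁆⁻

    ⊂∪⁅⁆ : ∀ {A : Subset n} {j} → j ∉ A → A ⊂ A ∪ ⁅ j ⁆
    ⊂∪⁅⁆ j∉A = p⊆p∪q ⁅ _ ⁆ , _ , ∈∪⁅⁆ , j∉A

  incomparable-by : ∀ {x y : Subset n} {e e′} → e ∈ x → e ∉ y → e′ ∈ y → e′ ∉ x → Incomparable x y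
  incomparable-by e∈x e∉y e′∈y e′∉x = (λ x⊆y → e∉y (x⊆y e∈x)) , (λ y⊆x → e′∉x (y⊆x e′∈y))

  common-top-P4 : ∀ {A A′ : Subset n} {i j k} → i ≢ j → i ∉ A → j ∉ A′ → A ∪ ⁅ i ⁆ ≡ A′ ∪ ⁅ j ⁆ →
                  k ≢ i → k ∉ A → P4 A′ (A ∪ ⁅ i ⁆) A (A ∪ ⁅ k ⁆)
  common-top-P4 {A} {A′} {i} {j} {k} i≢j i∉A j∉A′ top≡ k≢i k∉A =
    inj₁ (subst (A′ ⊂_) (sym top≡) (⊂∪⁅⁆ j∉A′)) , inj₂ (⊂∪⁅⁆ i∉A) , inj₁ (⊂∪⁅⁆ k∉A) ,
    incomparable-by i∈A′ i∉A j∈A j∉A′ ,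
    incomparable-by ∈∪⁅⁆ (∉∪⁅⁆ i∉A (k≢i ∘ sym)) ∈∪⁅⁆ (∉∪⁅⁆ k∉A k≢i) ,
    incomparable-by i∈A′ (∉∪⁅⁆ i∉A (k≢i ∘ sym)) ∈∪⁅⁆ (∉∪⁅⁆ k∉A k≢i ∘ subst (k ∈_) (sym top≡) ∘ p⊆p∪q ⁅ j ⁆)
    where
    i∈A′ : i ∈ A′
    i∈A′ = Sum.[ (λ i∈A′ → i∈A′) , ⊥-elim ∘ i≢j ]′ (∈∪⁅⁆⁻ (subst (i ∈_) top≡ ∈∪⁅⁆))
    j∈A : j ∈ A
    j∈A = Sum.[ (λ j∈A → j∈A) , ⊥-elim ∘ i≢j ∘ sym ]′ (∈∪⁅⁆⁻ (subst (j ∈_) (sym top≡) ∈∪⁅⁆))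

module Counting {n : ℕ} (F : Family n) (free : P4Free (_∈F F))
                (edge : ∀ i → ∃ λ A → A ∈F F × i ∉ A × (A ∪ ⁅ i ⁆) ∈F F) where

  private
    m : ℕ
    m = size F

    bottom : Fin n → Subset n
    bottom i = proj₁ (edge i)

    bottom∈F : ∀ i → bottom i ∈F F
    bottom∈F i = proj₁ (proj₂ (edge i))

    i∉bottom : ∀ i → i ∉ bottom i
    i∉bottom i = proj₁ (proj₂ (proj₂ (edge i)))

    top∈F : ∀ i → (bottom i ∪ ⁅ i ⁆) ∈F F
    top∈F i = proj₂ (proj₂ (proj₂ (edge i)))

    Shared : Fin n → Set
    Shared i = ∃ λ j → j ≢ i × j ∉ bottom i × (bottom i ∪ ⁅ j ⁆) ∈F F

    shared? : ∀ i → Dec (Shared i)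
    shared? i = any? λ j → ¬? (j ≟ᶠ i) ×-dec ¬? (j ∈? bottom i) ×-dec ∈F? F (bottom i ∪ ⁅ j ⁆)

    tag : ∀ i → Dec (Shared i) → Fin m ⊎ Fin m
    tag i (no _)  = inj₁ (index (bottom∈F i))
    tag i (yes _) = inj₂ (index (top∈F i))

    index-injective : ∀ {x y} (x∈F : x ∈F F) (y∈F : y ∈F F) → index x∈F ≡ index y∈F → x ≡ y
    index-injective x∈F y∈F eq =
      trans (lookup-index x∈F) (trans (cong (lookup (members F)) eq) (sym (lookup-index y∈F)))

    tag-injective : ∀ i j di dj → tag i di ≡ tag j dj → i ≡ j
    tag-injective i j _ _ _ with i ≟ᶠ j
    tag-injective i j _ _ _ | yes i≡j = i≡j
    tag-injective i j (no unshared) (no _) eq | no i≢j =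
      ⊥-elim (unshared (j , i≢j ∘ sym , subst (j ∉_) (sym same) (i∉bottom j) ,
                        subst (λ A → (A ∪ ⁅ j ⁆) ∈F F) (sym same) (top∈F j)))
      where
      same : bottom i ≡ bottom j
      same = index-injective (bottom∈F i) (bottom∈F j) (inj₁-injective eq)
    tag-injective i j (yes (k , k≢i , k∉ , k-edge)) (yes _) eq | no i≢j =
      ⊥-elim (free (bottom∈F j) (top∈F i) (bottom∈F i) k-edge
                   (common-top-P4 i≢j (i∉bottom i) (i∉bottom j) same k≢i k∉))
      where
      same : bottom i ∪ ⁅ i ⁆ ≡ bottom j ∪ ⁅ j ⁆
      same = index-injective (top∈F i) (top∈F j) (inj₂-injective eq)
    tag-injective i j (no _) (yes _) () | no _
    tag-injective i j (yes _) (no _) () | no _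

  n≤|F|+|F| : n ≤ size F + size F
  n≤|F|+|F| = injective⇒≤ {f = λ i → join m m (tag i (shared? i))} λ eq →
    tag-injective _ _ (shared? _) (shared? _)
                  (trans (sym (splitAt-join m m _)) (trans (cong (splitAt m) eq) (splitAt-join m m _)))

-- prefix k = {0, …, k - 1}
prefix : ℕ → Subset n
prefix {zero}  _       = []
prefix {suc n} zero    = outside ∷ prefix zero
prefix {suc n} (suc k) = inside ∷ prefix k

∈prefix⁺ : ∀ {k} {e : Fin n} → toℕ e < k → e ∈ prefix k
∈prefix⁺ {k = suc k} {zero}  _         = here
∈prefix⁺ {k = suc k} {suc e} (s≤s e<k) = there (∈prefix⁺ e<k)

∈prefix⁻ : ∀ {k} {e : Fin n} → e ∈ prefix k → toℕ e < k
∈prefix⁻ {k = zero}  {suc e} (there e∈) = ⊥-elim (n≮0 (∈prefix⁻ {k = zero} e∈))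
∈prefix⁻ {k = suc k} {zero}  here       = s≤s z≤n
∈prefix⁻ {k = suc k} {suc e} (there e∈) = s≤s (∈prefix⁻ e∈)

prefix-mono : ∀ {k l} → k ≤ l → prefix {n} k ⊆ prefix l
prefix-mono k≤l = ∈prefix⁺ ∘ (λ e<k → ≤-trans e<k k≤l) ∘ ∈prefix⁻

max-element : (X : Subset n) → Nonempty X → ∃ λ x → x ∈ X × ∀ {e} → e ∈ X → e ≤ᶠ x
max-element (s ∷ X) nonempty with nonempty? X
... | yes (e , e∈X) with max-element X (e , e∈X)
...   | x , x∈X , x-max = suc x , there x∈X , λ { here → z≤n ; (there e∈X) → s≤s (x-max e∈X) }
max-element (s ∷ X) (zero , here)       | no empty =
  zero , here , λ { here → z≤n ; (there e∈X) → ⊥-elim (empty (_ , e∈X)) }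
max-element (s ∷ X) (suc e , there e∈X) | no empty = ⊥-elim (empty (e , e∈X))

⁅⁆⊆ : ∀ {x : Fin n} {X} → x ∈ X → ⁅ x ⁆ ⊆ X
⁅⁆⊆ {x = x} {X} x∈X e∈ = subst (_∈ X) (sym (x∈⁅y⁆⇒x≡y x e∈)) x∈X

prefix-N : ∀ {X : Subset n} {x₁ x₂ p} → x₁ ∈ X → x₂ ∈ X → p ∉ X → x₂ <ᶠ x₁ → p <ᶠ x₁ →
           InducedN ⁅ x₁ ⁆ ⁅ x₂ ⁆ X (prefix (toℕ x₁))
prefix-N {x₁ = x₁} {x₂} {p} x₁∈X x₂∈X p∉X x₂<x₁ p<x₁ =
  induced-N (⁅⁆⊆ x₁∈X , x₂ , x₂∈X , x₂∉⁅x₁⁆) (⁅⁆⊆ x₂∈X , x₁ , x₁∈X , x₁∉⁅x₂⁆)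
            (⁅⁆⊆ (∈prefix⁺ x₂<x₁) , p , ∈prefix⁺ p<x₁ , x≢y⇒x∉⁅y⁆ λ { refl → p∉X x₂∈X })
            (incomparable-by (x∈⁅x⁆ x₁) x₁∉⁅x₂⁆ (x∈⁅x⁆ x₂) x₂∉⁅x₁⁆)
            (incomparable-by (x∈⁅x⁆ x₁) x₁∉prefix (∈prefix⁺ p<x₁) (x≢y⇒x∉⁅y⁆ (<ᶠ⇒≢ p<x₁)))
            (incomparable-by x₁∈X x₁∉prefix (∈prefix⁺ p<x₁) p∉X)
  where
  x₂∉⁅x₁⁆ : x₂ ∉ ⁅ x₁ ⁆
  x₂∉⁅x₁⁆ = x≢y⇒x∉⁅y⁆ (<ᶠ⇒≢ x₂<x₁)
  x₁∉⁅x₂⁆ : x₁ ∉ ⁅ x₂ ⁆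
  x₁∉⁅x₂⁆ = x≢y⇒x∉⁅y⁆ (≢-sym (<ᶠ⇒≢ x₂<x₁))
  x₁∉prefix : x₁ ∉ prefix (toℕ x₁)
  x₁∉prefix = <-irrefl refl ∘ ∈prefix⁻

module PrefixFamily (n : ℕ) where

  candidates : List (Subset n)
  candidates = applyUpTo prefix (suc n) ++ tabulate ⁅_⁆

  family₀ : Family n
  family₀ = family (deduplicate _≟ˢ_ candidates) (deduplicate-! _≟ˢ_ candidates)

  size-family₀ : size family₀ ≤ suc n + n
  size-family₀ = subst (size family₀ ≤_) lengths (length-deduplicate _≟ˢ_ candidates)
    where
    lengths : length candidates ≡ suc n + n
    lengths = trans (length-++ (applyUpTo prefix (suc n)))
                    (cong₂ _+_ (length-applyUpTo prefix (suc n)) (length-tabulate ⁅_⁆))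

  prefix∈ : ∀ {k} → k ≤ n → prefix k ∈F family₀
  prefix∈ k≤n = ∈-deduplicate⁺ _≟ˢ_ (∈-++⁺ˡ (∈-applyUpTo⁺ prefix (s≤s k≤n)))

  ⁅⁆∈ : ∀ x → ⁅ x ⁆ ∈F family₀
  ⁅⁆∈ x = ∈-deduplicate⁺ _≟ˢ_ (∈-++⁺ʳ (applyUpTo prefix (suc n)) (∈-tabulate⁺ x))

  ∈family₀⁻ : ∀ {Y} → Y ∈F family₀ → (∃ λ k → Y ≡ prefix k) ⊎ (∃ λ x → Y ≡ ⁅ x ⁆)
  ∈family₀⁻ Y∈ with ∈-++⁻ (applyUpTo prefix (suc n)) (∈-deduplicate⁻ _≟ˢ_ candidates Y∈)
  ... | inj₁ Y∈prefixes   = inj₁ (let (k , _ , Y≡) = ∈-applyUpTo⁻ prefix Y∈prefixes in k , Y≡)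
  ... | inj₂ Y∈singletons = inj₂ (∈-tabulate⁻ Y∈singletons)

  -- A singleton has no nonempty proper subset.
  ⊃nonempty⇒prefix : ∀ {Y Z e} → Y ∈F family₀ → Z ⊂ Y → e ∈ Z → ∃ λ k → Y ≡ prefix k
  ⊃nonempty⇒prefix Y∈ Z⊂Y e∈Z with ∈family₀⁻ Y∈
  ... | inj₁ is-prefix = is-prefix
  ... | inj₂ (x , refl) with Z⊂Y
  ...   | Z⊆⁅x⁆ , y , y∈⁅x⁆ , y∉Z =
          ⊥-elim (y∉Z (subst (_∈ _) (trans (x∈⁅y⁆⇒x≡y x (Z⊆⁅x⁆ e∈Z)) (sym (x∈⁅y⁆⇒x≡y x y∈⁅x⁆))) e∈Z))

  N-free : ¬ ContainsN (_∈F family₀)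
  N-free (_ , _ , _ , _ , _ , _ , R∈ , S∈ ,
          (_ , _ , _ , _ , _ , _ , P⊂R , _ , Q⊂S , (P⊈Q , Q⊈P) , _ , (R⊈S , S⊈R)))
    with ⊃nonempty⇒prefix R∈ P⊂R (proj₁ (proj₂ (⊈⇒∃ P⊈Q))) | ⊃nonempty⇒prefix S∈ Q⊂S (proj₁ (proj₂ (⊈⇒∃ Q⊈P)))
  ... | r , refl | s , refl with ≤-total r s
  ...   | inj₁ r≤s = R⊈S (prefix-mono r≤s)
  ...   | inj₂ s≤r = S⊈R (prefix-mono s≤r)

  -- With x₁ the largest element of X and p < x₁ missing from X, any other x₂ ∈ X gives prefix-N.
  saturated : ∀ X → X ∉F family₀ → ContainsN (family₀ ∪₁ X)
  saturated X X∉ with nonempty? X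
  ... | no empty = ⊥-elim (X∉ (subst (_∈F family₀) (sym X≡∅) (prefix∈ z≤n)))
    where
    X≡∅ : X ≡ prefix 0
    X≡∅ = ⊆-antisym (λ e∈X → ⊥-elim (empty (_ , e∈X))) (⊥-elim ∘ n≮0 ∘ ∈prefix⁻)
  ... | yes nonempty with max-element X nonempty
  ...   | x₁ , x₁∈X , x₁-max with any? (λ p → (p <ᶠ? x₁) ×-dec ¬? (p ∈? X))
  ...     | no no-gap = ⊥-elim (X∉ (subst (_∈F family₀) (sym X≡prefix) (prefix∈ (toℕ<n x₁))))
    where
    prefix⊆X : prefix (suc (toℕ x₁)) ⊆ X
    prefix⊆X {e} e∈ with e ≟ᶠ x₁
    ... | yes refl = x₁∈X
    ... | no e≢x₁ = decidable-stable (e ∈? X) λ e∉X → no-gap (e , ≤ᶠ∧≢⇒<ᶠ (s≤s⁻¹ (∈prefix⁻ e∈)) e≢x₁ , e∉X)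
    X≡prefix : X ≡ prefix (suc (toℕ x₁))
    X≡prefix = ⊆-antisym (∈prefix⁺ ∘ s≤s ∘ x₁-max) prefix⊆X
  ...     | yes (p , p<x₁ , p∉X) =
            _ , _ , _ , _ , inj₁ (⁅⁆∈ x₁) , inj₁ (⁅⁆∈ x₂) , inj₂ refl , inj₁ (prefix∈ (<⇒≤ (toℕ<n x₁))) ,
            prefix-N x₁∈X x₂∈X p∉X (≤ᶠ∧≢⇒<ᶠ (x₁-max x₂∈X) (x∉⁅y⁆⇒x≢y x₂∉⁅x₁⁆)) p<x₁
    where
    X⊈⁅x₁⁆ : ¬ X ⊆ ⁅ x₁ ⁆
    X⊈⁅x₁⁆ X⊆ = X∉ (subst (_∈F family₀) (⊆-antisym (⁅⁆⊆ x₁∈X) X⊆) (⁅⁆∈ x₁))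
    x₂ : Fin n
    x₂ = proj₁ (⊈⇒∃ X⊈⁅x₁⁆)
    x₂∈X : x₂ ∈ X
    x₂∈X = proj₁ (proj₂ (⊈⇒∃ X⊈⁅x₁⁆))
    x₂∉⁅x₁⁆ : x₂ ∉ ⁅ x₁ ⁆
    x₂∉⁅x₁⁆ = proj₂ (proj₂ (⊈⇒∃ X⊈⁅x₁⁆))

least-witness : ∀ {P : ℕ → Set} → (∀ m → Dec (P m)) → ∀ {b} → P b → ∃ λ m → P m × ∀ {j} → j < m → ¬ P j
least-witness P? {b} Pb with P? 0
... | yes P0 = 0 , P0 , λ ()
least-witness P? {zero}  P0 | no ¬P0 = ⊥-elim (¬P0 P0)
least-witness P? {suc b} Pb | no ¬P0 with least-witness (P? ∘ suc) Pb
... | m , Pm , below = suc m , Pm , λ { {zero} _ → ¬P0 ; {suc j} (s≤s j<m) → below j<m }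

module Decisions (n : ℕ) where

  allSubsets? : ∀ {P : Subset n → Set} → (∀ X → Dec (P X)) → Dec (∀ X → P X)
  allSubsets? P? = map′ (λ none X → decidable-stable (P? X) (none ∘ (X ,_))) (λ all (X , ¬PX) → ¬PX (all X))
                        (¬? (anySubset? (¬? ∘ P?)))

  InducedN? : ∀ (P Q R S : Subset n) → Dec (InducedN P Q R S)
  InducedN? P Q R S =
    ¬? (P ≟ˢ Q) ×-dec ¬? (P ≟ˢ R) ×-dec ¬? (P ≟ˢ S) ×-dec ¬? (Q ≟ˢ R) ×-dec ¬? (Q ≟ˢ S) ×-dec ¬? (R ≟ˢ S) ×-dec
    (P ⊂? R) ×-dec (Q ⊂? R) ×-dec (Q ⊂? S) ×-dec Incomparable? P Q ×-dec Incomparable? P S ×-dec Incomparable? R S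

  ContainsN? : ∀ {Mem : Subset n → Set} → (∀ X → Dec (Mem X)) → Dec (ContainsN Mem)
  ContainsN? Mem? =
    anySubset? λ P → anySubset? λ Q → anySubset? λ R → anySubset? λ S →
      Mem? P ×-dec Mem? Q ×-dec Mem? R ×-dec Mem? S ×-dec InducedN? P Q R S

  NSaturated? : (F : Family n) → Dec (NSaturated F)
  NSaturated? F =
    ¬? (ContainsN? (∈F? F)) ×-dec allSubsets? λ X → ¬? (∈F? F X) →-dec ContainsN? λ Y → ∈F? F Y ⊎-dec (Y ≟ˢ X)

  lists-of-length? : ∀ j {P : List (Subset n) → Set} → (∀ xs → Dec (P xs)) → Dec (∃ λ xs → length xs ≡ j × P xs)
  lists-of-length? zero    P? = map′ (λ P[] → [] , refl , P[]) (λ { ([] , _ , P[]) → P[] }) (P? [])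
  lists-of-length? (suc j) P? =
    map′ (λ (x , xs , len , Pxs) → x ∷ xs , cong suc len , Pxs)
         (λ { (x ∷ xs , len , Pxs) → x , xs , suc-injective len , Pxs })
         (anySubset? λ x → lists-of-length? j (P? ∘ (x ∷_)))

  SaturatedOfSize : ℕ → Set
  SaturatedOfSize j = ∃ λ (F : Family n) → NSaturated F × size F ≡ j

  SaturatedOfSize? : ∀ j → Dec (SaturatedOfSize j)
  SaturatedOfSize? j = map′ (λ (xs , len , u , sat) → family xs u , sat , len)
                            (λ (F , sat , len) → members F , len , unique F , sat)
                            (lists-of-length? j saturated-list?)
    where
    saturated-list? : ∀ xs → Dec (Σ _ λ u → NSaturated (family xs u))
    saturated-list? xs with allPairs? (λ x y → ¬? (x ≟ˢ y)) xs
    ... | no ¬u = no (¬u ∘ proj₁)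
    ... | yes u = map′ (u ,_) proj₂ (NSaturated? (family xs u))

  least-saturated : ∀ (F : Family n) → NSaturated F → ∃ (IsSatStar n)
  least-saturated F sat with least-witness SaturatedOfSize? (F , sat , refl)
  ... | m , smallest , below = m , smallest , λ F′ sat′ → ≮⇒≥ λ F′<m → below F′<m (F′ , sat′ , refl)

saturated⇒n≤|F|+|F| : (F : Family n) → NSaturated F → n ≤ size F + size F
saturated⇒n≤|F|+|F| F saturated =
  Counting.n≤|F|+|F| F (N-free⇒P4Free (proj₁ saturated)) (Saturated.coordinate-edge F saturated)

sat*-exists : ∀ n → ∃ (IsSatStar n)
sat*-exists n = Decisions.least-saturated n family₀ (N-free , saturated)
  where open PrefixFamily n

sat*-lower : ∀ {m} → IsSatStar n m → n ≤ m + m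
sat*-lower ((F , F-saturated , refl) , _) = saturated⇒n≤|F|+|F| F F-saturated

sat*-upper : ∀ {m} → IsSatStar n m → m ≤ suc n + n
sat*-upper {n} (_ , minimal) = ≤-trans (minimal family₀ (N-free , saturated)) size-family₀
  where open PrefixFamily n

m+m≡2*m : ∀ m → m + m ≡ 2 * m
m+m≡2*m m = cong (m +_) (sym (+-identityʳ m))

1+n+n≤3*n : 1 ≤ n → suc n + n ≤ 3 * n
1+n+n≤3*n {n} 1≤n = subst (suc n + n ≤_) (cong (n +_) (m+m≡2*m n)) (+-monoˡ-≤ (n + n) 1≤n)

theorem4p3 : Σ ℕ λ k → Σ ℕ λ K → Σ ℕ λ n₀ → ∀ (n : ℕ) → n ≥ n₀ →
    Σ ℕ λ m → IsSatStar n m × (n ≤ suc k * m) × (m ≤ suc K * n)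
theorem4p3 = 1 , 2 , 1 , λ n 1≤n →
  let (m , sat*) = sat*-exists n in
  m , sat* , subst (n ≤_) (m+m≡2*m m) (sat*-lower sat*) , ≤-trans (sat*-upper sat*) (1+n+n≤3*n 1≤n)
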